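{- For every $n\ge 1$, the number of inversion sequences $e\in I_n(010,101,120,201)$ in which every left-to-right maximum is high equals the number of rushed Dyck paths of semilength $n+1$; i.e. these inversion sequences are enumerated by the sequence A287709 of the OEIS.
   Context: An inversion sequence of length $n$ is an integer sequence $e=(e_1,\dots,e_n)$ with $0\le e_j\le j-1$. $e$ contains a pattern $f=(f_1,\dots,f_m)$ if there are indices $i_1<\dots<i_m$ with $e_{i_a}<e_{i_b}$ iff $f_a<f_b$ and $e_{i_a}=e_{i_b}$ iff $f_a=f_b$ for all $a,b$; otherwise it avoids $f$. $I_n(T)$ is the set of inversion sequences of length $n$ avoiding all patterns in $T$. An entry $e_j$ is high if $e_j=j-1$, and is a left-to-right maximum if $e_j>e_i$ for all $i<j$. A Dyck path of semilength $m$ is a lattice path from $(0,0)$ to $(2m,0)$ with steps $(1,1)$, $(1,-1)$ never going below the $x$-axis; it is rushed if it starts with $h\ge1$ up-steps and afterwards never visits altitude $h$ again. -}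

module Defs where

open import Data.Bool using (Bool; true; false; _∧_; _∨_; not; if_then_else_)
open import Data.Nat using (ℕ; zero; suc; _≡ᵇ_; _<ᵇ_; _∸_)
open import Data.List using (List; []; _∷_; _++_; [_]; map; concatMap; upTo; length; filterᵇ; zip)
open import Data.Bool.ListAction using (all; any)
open import Data.Product using (_×_; _,_; proj₁; proj₂)

-- Inversion sequences (lists of naturals, entries e_1 … e_n, 1-indexed)

invSeqs : ℕ → List (List ℕ)
invSeqs zero    = [] ∷ []
invSeqs (suc n) = concatMap (λ e → map (λ x → e ++ [ x ]) (upTo (suc n))) (invSeqs n)

_⇔ᵇ_ : Bool → Bool → Bool
true  ⇔ᵇ b = b
false ⇔ᵇ b = not b

samePair : ℕ → ℕ → ℕ → ℕ → Bool
samePair x y u v = ((x <ᵇ y) ⇔ᵇ (u <ᵇ v)) ∧ ((x ≡ᵇ y) ⇔ᵇ (u ≡ᵇ v))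

orderIso : List ℕ → List ℕ → Bool
orderIso []       []       = true
orderIso []       (_ ∷ _)  = false
orderIso (_ ∷ _)  []       = false
orderIso (x ∷ xs) (u ∷ us) =
  all (λ p → samePair x (proj₁ p) u (proj₂ p)) (zip xs us) ∧ orderIso xs us

subseqs : List ℕ → List (List ℕ)
subseqs []       = [] ∷ []
subseqs (x ∷ xs) = let r = subseqs xs in map (x ∷_) r ++ r

contains : List ℕ → List ℕ → Bool
contains e f = any (λ w → orderIso w f) (subseqs e)

avoids : List ℕ → List ℕ → Bool
avoids e f = not (contains e f)

avoidsAll : List ℕ → List (List ℕ) → Bool
avoidsAll e T = all (avoids e) T

-- Every left-to-right maximum is high.
-- lrHighFrom j m e : e = (e_j, e_{j+1}, …), and m = max(e_1,…,e_{j-1}) + 1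
-- (m = 0 when j = 1). e_j is a left-to-right maximum iff e_j + 1 > m,
-- i.e. e_j > e_i for all i < j; it is high iff e_j = j - 1.
lrHighFrom : ℕ → ℕ → List ℕ → Bool
lrHighFrom j m []       = true
lrHighFrom j m (x ∷ xs) with m <ᵇ suc x
... | true  = (x ≡ᵇ (j ∸ 1)) ∧ lrHighFrom (suc j) (suc x) xs
... | false = lrHighFrom (suc j) m xs

allLRMaxHigh : List ℕ → Bool
allLRMaxHigh e = lrHighFrom 1 0 e

patterns : List (List ℕ)
patterns = (0 ∷ 1 ∷ 0 ∷ []) ∷ (1 ∷ 0 ∷ 1 ∷ []) ∷ (1 ∷ 2 ∷ 0 ∷ []) ∷ (2 ∷ 0 ∷ 1 ∷ []) ∷ []

countInv : ℕ → ℕ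
countInv n = length (filterᵇ (λ e → avoidsAll e patterns ∧ allLRMaxHigh e) (invSeqs n))

-- Dyck paths: lists of steps, true = up step (1,1), false = down step (1,-1)

allWords : ℕ → List (List Bool)
allWords zero    = [] ∷ []
allWords (suc k) = let r = allWords k in map (true ∷_) r ++ map (false ∷_) r

dyckFrom : ℕ → List Bool → Bool
dyckFrom h         []           = h ≡ᵇ 0
dyckFrom h         (true ∷ s)   = dyckFrom (suc h) s
dyckFrom zero      (false ∷ s)  = false
dyckFrom (suc h)   (false ∷ s)  = dyckFrom h s

isDyck : List Bool → Bool
isDyck s = dyckFrom 0 s

leadUps : List Bool → ℕ × List Bool
leadUps (true ∷ s) with leadUps s
... | (k , r) = (suc k , r)
leadUps s = (0 , s)

neverVisits : ℕ → ℕ → List Bool → Bool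
neverVisits h a []          = true
neverVisits h a (true ∷ s)  = not (suc a ≡ᵇ h) ∧ neverVisits h (suc a) s
neverVisits h a (false ∷ s) = not ((a ∸ 1) ≡ᵇ h) ∧ neverVisits h (a ∸ 1) s

isRushed : List Bool → Bool
isRushed s with leadUps s
... | (zero  , r) = false
... | (suc k , r) = neverVisits (suc k) (suc k) r

countRushed : ℕ → ℕ
countRushed m = length (filterᵇ (λ s → isDyck s ∧ isRushed s) (allWords (m Data.Nat.+ m)))

-- Both sides are counted along the generating tree in which a node (a, d) has the children
-- (d, 0) and (i, d + 1) for i ≤ a.  Let e be one of the inversion sequences counted by
-- countInv n, with maximum M and last entry v, and let L be one more than its maximum before
-- its last left-to-right maximum.  A new last entry y completes an occurrence of a pattern iff
-- y < L or v < y ≤ M, and a new left-to-right maximum must be n, so e extends exactly by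
-- L, …, v and by n; hence e sits at the node (v − L, n − 1 − M) and countInv (m + 1) is the
-- number of nodes at depth m below (0, 0).
-- A rushed Dyck path of semilength n + 1 is a run of c + 1 up-steps followed by a walk from c
-- down to 0 inside the strip [0, c].  Counting these by their number of returns to altitude c,
-- and deleting the excursions to the top level of a strip, gives a recurrence which together
-- with the hockey-stick identity yields tree r a d = ∑_t C(a + t, t) R(d + t, d + r + 1), where
-- R(q, n) counts the rushed paths of semilength n + 1 returning q times; for (r, a, d) = (m, 0, 0)
-- this is the number of all rushed paths of semilength m + 2.

module Submission where

open import Data.Bool using (Bool; true; false; not; _∧_; _∨_; if_then_else_)
open import Data.Bool.Properties
  using (T-≡; ¬-not; ∨-commutativeMonoid; ∧-commutativeMonoid; ∧-zeroʳ; ∧-assoc; ∨-zeroʳ; ∨-identityʳ; ∨-assoc)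
open import Data.Bool.ListAction using (any)
open import Data.Empty using (⊥-elim)
open import Data.List using (List; []; _∷_; _++_; [_]; map; length; foldl; concatMap; upTo; applyUpTo; filterᵇ)
open import Data.List.Properties using (map-++; map-∘; map-cong; map-cong-local; foldl-++)
open import Data.List.Membership.Propositional using (_∈_)
open import Data.List.Relation.Unary.All using (All; []; _∷_)
import Data.List.Relation.Unary.All as All
import Data.List.Relation.Unary.All.Properties as All
open import Data.List.Relation.Unary.Any using (here; there)
import Data.List.Relation.Unary.Any.Properties as Any
open import Data.Nat
open import Data.Nat.ListAction using (sum)
open import Data.Nat.ListAction.Properties using (sum-++)
open import Data.Nat.Properties
open import Data.Nat.Tactic.RingSolver using (solve-∀)
open import Data.Product using (_×_; _,_; proj₁; proj₂)
open import Data.Sum using (_⊎_; inj₁; inj₂; map₂)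
open import Function using (_∘_)
open import Function.Bundles using (Equivalence)
open import Relation.Binary.Definitions using (tri<; tri≈; tri>)
open import Relation.Binary.PropositionalEquality hiding ([_])
open import Relation.Nullary using (¬_; yes; no; contradiction)
open import Algebra.Bundles using (CommutativeMonoid)
import Algebra.Properties.CommutativeSemigroup as CommSemigroupProperties

open import Defs

open ≡-Reasoning
open CommSemigroupProperties +-commutativeSemigroup using () renaming (interchange to +-interchange)
open CommSemigroupProperties (CommutativeMonoid.commutativeSemigroup ∨-commutativeMonoid)
  using () renaming (interchange to ∨-interchange)
open CommSemigroupProperties (CommutativeMonoid.commutativeSemigroup ∧-commutativeMonoid)
  using () renaming (interchange to ∧-interchange)
open Equivalence using (to; from)

<ᵇ-true : ∀ {m n} → m < n → (m <ᵇ n) ≡ true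
<ᵇ-true m<n = T-≡ .to (<⇒<ᵇ m<n)

<ᵇ-false : ∀ {m n} → n ≤ m → (m <ᵇ n) ≡ false
<ᵇ-false {m} {n} n≤m = ¬-not (λ eq → ≤⇒≯ n≤m (<ᵇ⇒< m n (T-≡ .from eq)))

≡ᵇ-true : ∀ {m n} → m ≡ n → (m ≡ᵇ n) ≡ true
≡ᵇ-true {m} {n} m≡n = T-≡ .to (≡⇒≡ᵇ m n m≡n)

≡ᵇ-false : ∀ {m n} → m ≢ n → (m ≡ᵇ n) ≡ false
≡ᵇ-false {m} {n} m≢n = ¬-not (λ eq → m≢n (≡ᵇ⇒≡ m n (T-≡ .from eq)))

∑< : ℕ → (ℕ → ℕ) → ℕ
∑< zero    f = 0
∑< (suc n) f = f 0 + ∑< n (f ∘ suc)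

syntax ∑< n (λ i → f) = ∑[ i < n ] f

∑-cong : ∀ n {f g : ℕ → ℕ} → (∀ i → i < n → f i ≡ g i) → ∑< n f ≡ ∑< n g
∑-cong zero    f≡g = refl
∑-cong (suc n) f≡g = cong₂ _+_ (f≡g 0 z<s) (∑-cong n (λ i i<n → f≡g (suc i) (s<s i<n)))

∑-zero : ∀ n {f : ℕ → ℕ} → (∀ i → i < n → f i ≡ 0) → ∑< n f ≡ 0
∑-zero zero    f≡0 = refl
∑-zero (suc n) f≡0 = cong₂ _+_ (f≡0 0 z<s) (∑-zero n (λ i i<n → f≡0 (suc i) (s<s i<n)))

∑-last : ∀ n (f : ℕ → ℕ) → ∑< (suc n) f ≡ ∑< n f + f n
∑-last zero    f = +-comm (f 0) 0
∑-last (suc n) f = trans (cong (f 0 +_) (∑-last n (f ∘ suc))) (sym (+-assoc (f 0) _ _))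

∑-++ : ∀ m n (f : ℕ → ℕ) → ∑< (m + n) f ≡ ∑< m f + ∑[ i < n ] f (m + i)
∑-++ zero    n f = refl
∑-++ (suc m) n f = trans (cong (f 0 +_) (∑-++ m n (f ∘ suc))) (sym (+-assoc (f 0) _ _))

∑-trailing-zeros : ∀ n m {f : ℕ → ℕ} → n ≤ m → (∀ i → n ≤ i → i < m → f i ≡ 0) → ∑< m f ≡ ∑< n f
∑-trailing-zeros n m {f} n≤m f≡0 = begin
  ∑< m f                                  ≡⟨ cong (λ k → ∑< k f) (sym (m+[n∸m]≡n n≤m)) ⟩
  ∑< (n + (m ∸ n)) f                      ≡⟨ ∑-++ n (m ∸ n) f ⟩
  ∑< n f + ∑[ i < m ∸ n ] f (n + i)       ≡⟨ cong (∑< n f +_) (∑-zero (m ∸ n) tail≡0) ⟩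
  ∑< n f + 0                              ≡⟨ +-identityʳ _ ⟩
  ∑< n f                                  ∎
  where
  tail≡0 : ∀ i → i < m ∸ n → f (n + i) ≡ 0
  tail≡0 i i<m∸n = f≡0 (n + i) (m≤m+n n i) (subst (n + i <_) (m+[n∸m]≡n n≤m) (+-monoʳ-< n i<m∸n))

∑-distrib-+ : ∀ n (f g : ℕ → ℕ) → ∑[ i < n ] (f i + g i) ≡ ∑< n f + ∑< n g
∑-distrib-+ zero    f g = refl
∑-distrib-+ (suc n) f g =
  trans (cong (f 0 + g 0 +_) (∑-distrib-+ n (f ∘ suc) (g ∘ suc))) (+-interchange (f 0) (g 0) _ _)

*-distribˡ-∑ : ∀ n c (f : ℕ → ℕ) → ∑[ i < n ] (c * f i) ≡ c * ∑< n f
*-distribˡ-∑ zero    c f = sym (*-zeroʳ c)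
*-distribˡ-∑ (suc n) c f = trans (cong (c * f 0 +_) (*-distribˡ-∑ n c (f ∘ suc))) (sym (*-distribˡ-+ c (f 0) _))

*-distribʳ-∑ : ∀ n c (f : ℕ → ℕ) → ∑[ i < n ] (f i * c) ≡ ∑< n f * c
*-distribʳ-∑ zero    c f = refl
*-distribʳ-∑ (suc n) c f = trans (cong (f 0 * c +_) (*-distribʳ-∑ n c (f ∘ suc))) (sym (*-distribʳ-+ c (f 0) _))

∑-+-*ʳ : ∀ n (f g h : ℕ → ℕ) → ∑[ i < n ] (f i * h i) + ∑[ i < n ] (g i * h i) ≡ ∑[ i < n ] ((f i + g i) * h i)
∑-+-*ʳ n f g h = trans (sym (∑-distrib-+ n (λ i → f i * h i) (λ i → g i * h i)))
                       (∑-cong n (λ i _ → sym (*-distribʳ-+ (h i) (f i) (g i))))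

∑-*-+ˡ : ∀ n (f g h : ℕ → ℕ) → ∑[ i < n ] (f i * g i) + ∑[ i < n ] (f i * h i) ≡ ∑[ i < n ] (f i * (g i + h i))
∑-*-+ˡ n f g h = trans (sym (∑-distrib-+ n (λ i → f i * g i) (λ i → f i * h i)))
                       (∑-cong n (λ i _ → sym (*-distribˡ-+ (f i) (g i) (h i))))

∑-comm : ∀ n m (f : ℕ → ℕ → ℕ) → ∑[ i < n ] ∑[ j < m ] f i j ≡ ∑[ j < m ] ∑[ i < n ] f i j
∑-comm zero    m f = sym (∑-zero m (λ _ _ → refl))
∑-comm (suc n) m f =
  trans (cong (∑[ j < m ] f 0 j +_) (∑-comm n m (f ∘ suc))) (sym (∑-distrib-+ m (f 0) (λ j → ∑[ i < n ] f (suc i) j)))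

∑∈ : {A : Set} → List A → (A → ℕ) → ℕ
∑∈ xs f = sum (map f xs)

syntax ∑∈ xs (λ x → f) = ∑[ x ∈ xs ] f

𝟙 : Bool → ℕ
𝟙 b = if b then 1 else 0

module _ {A : Set} where

  length-filterᵇ : ∀ (p : A → Bool) xs → length (filterᵇ p xs) ≡ ∑[ x ∈ xs ] 𝟙 (p x)
  length-filterᵇ p []       = refl
  length-filterᵇ p (x ∷ xs) with p x
  ... | true  = cong suc (length-filterᵇ p xs)
  ... | false = length-filterᵇ p xs

  ∑∈-cong : ∀ {f g : A → ℕ} xs → All (λ x → f x ≡ g x) xs → ∑∈ xs f ≡ ∑∈ xs g
  ∑∈-cong xs f≡g = cong sum (map-cong-local f≡g)

  ∑∈-cong-≗ : ∀ {f g : A → ℕ} xs → (∀ x → f x ≡ g x) → ∑∈ xs f ≡ ∑∈ xs g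
  ∑∈-cong-≗ xs f≡g = cong sum (map-cong f≡g xs)

  ∑∈-zero : ∀ {f : A → ℕ} xs → (∀ x → f x ≡ 0) → ∑∈ xs f ≡ 0
  ∑∈-zero []       f≡0 = refl
  ∑∈-zero (x ∷ xs) f≡0 = cong₂ _+_ (f≡0 x) (∑∈-zero xs f≡0)

  ∑∈-++ : ∀ xs ys (f : A → ℕ) → ∑∈ (xs ++ ys) f ≡ ∑∈ xs f + ∑∈ ys f
  ∑∈-++ xs ys f = trans (cong sum (map-++ f xs ys)) (sum-++ (map f xs) (map f ys))

  ∑∈-map : ∀ {B : Set} (g : B → A) xs (f : A → ℕ) → ∑∈ (map g xs) f ≡ ∑∈ xs (f ∘ g)
  ∑∈-map g xs f = cong sum (sym (map-∘ xs))

  ∑∈-concatMap : ∀ {B : Set} (h : B → List A) xs (f : A → ℕ) → ∑∈ (concatMap h xs) f ≡ ∑[ x ∈ xs ] ∑∈ (h x) f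
  ∑∈-concatMap h []       f = refl
  ∑∈-concatMap h (x ∷ xs) f = trans (∑∈-++ (h x) (concatMap h xs) f) (cong (∑∈ (h x) f +_) (∑∈-concatMap h xs f))

  ∑∈-applyUpTo : ∀ (g : ℕ → A) n (f : A → ℕ) → ∑∈ (applyUpTo g n) f ≡ ∑[ i < n ] f (g i)
  ∑∈-applyUpTo g zero    f = refl
  ∑∈-applyUpTo g (suc n) f = cong (f (g 0) +_) (∑∈-applyUpTo (g ∘ suc) n f)

-- lattice a t = C(a + t, t) and multichoose m p = C(m + p - 1, p)

lattice : ℕ → ℕ → ℕ
lattice a       zero    = 1
lattice zero    (suc t) = 1
lattice (suc a) (suc t) = lattice a (suc t) + lattice (suc a) t

multichoose : ℕ → ℕ → ℕ
multichoose zero    zero    = 1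
multichoose zero    (suc p) = 0
multichoose (suc m) p       = lattice m p

lattice-zeroˡ : ∀ t → lattice 0 t ≡ 1
lattice-zeroˡ zero    = refl
lattice-zeroˡ (suc t) = refl

lattice-sym : ∀ a t → lattice a t ≡ lattice t a
lattice-sym zero    zero    = refl
lattice-sym zero    (suc t) = refl
lattice-sym (suc a) zero    = refl
lattice-sym (suc a) (suc t) = begin
  lattice a (suc t) + lattice (suc a) t ≡⟨ cong₂ _+_ (lattice-sym a (suc t)) (lattice-sym (suc a) t) ⟩
  lattice (suc t) a + lattice t (suc a) ≡⟨ +-comm (lattice (suc t) a) _ ⟩
  lattice t (suc a) + lattice (suc t) a ∎

hockey-stick : ∀ a s → ∑[ i < suc a ] lattice i s ≡ lattice a (suc s)
hockey-stick zero    s = trans (+-identityʳ (lattice 0 s)) (lattice-zeroˡ s)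
hockey-stick (suc a) s = trans (∑-last (suc a) (λ i → lattice i s)) (cong (_+ lattice (suc a) s) (hockey-stick a s))

multichoose-zeroʳ : ∀ m → multichoose m 0 ≡ 1
multichoose-zeroʳ zero    = refl
multichoose-zeroʳ (suc m) = refl

lattice-split : ∀ q p → lattice q (suc p) ≡ multichoose q (suc p) + lattice q p
lattice-split zero    p = sym (lattice-zeroˡ p)
lattice-split (suc q) p = refl

-- Walks in a strip

-- walks c y p k counts the walks from altitude y down to 0 inside the strip [0, c] with
-- k up-steps which arrive at altitude c exactly p times; walksUp counts those starting
-- with an up-step (k then counts the remaining up-steps).

atPred : ℕ → (ℕ → ℕ) → ℕ
atPred zero    f = 0
atPred (suc p) f = f p

walks   : ℕ → ℕ → ℕ → ℕ → ℕ
walksUp : ℕ → ℕ → ℕ → ℕ → ℕ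
walks c zero    p       (suc k) = walksUp c zero p k
walks c zero    zero    zero    = 1
walks c zero    (suc p) zero    = 0
walks c (suc y) p       zero    = walks c y p zero
walks c (suc y) p       (suc k) = walks c y p (suc k) + walksUp c (suc y) p k
walksUp c y p k =
  if y <ᵇ c then (if suc y ≡ᵇ c then atPred p (λ p′ → walks c (suc y) p′ k) else walks c (suc y) p k) else 0

walks-vanish   : ∀ c y p k → k < p → walks c y p k ≡ 0
walksUp-vanish : ∀ c y p k → suc k < p → walksUp c y p k ≡ 0
walks-vanish c zero    zero    zero    ()
walks-vanish c zero    (suc p) zero    _   = refl
walks-vanish c zero    p       (suc k) k<p = walksUp-vanish c zero p k k<p
walks-vanish c (suc y) p       zero    k<p = walks-vanish c y p zero k<p
walks-vanish c (suc y) p       (suc k) k<p =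
  cong₂ _+_ (walks-vanish c y p (suc k) k<p) (walksUp-vanish c (suc y) p k k<p)
walksUp-vanish c y p k k<p with y <ᵇ c
... | false = refl
... | true with suc y ≡ᵇ c
...   | false = walks-vanish c (suc y) p k (<-trans (n<1+n k) k<p)
walksUp-vanish c y (suc p) k (s≤s k<p) | true | true = walks-vanish c (suc y) p k k<p

walksUp-inner : ∀ c y p k → suc y < c → walksUp c y p k ≡ walks c (suc y) p k
walksUp-inner c y p k y+1<c rewrite <ᵇ-true (<-trans (n<1+n y) y+1<c) | ≡ᵇ-false (<⇒≢ y+1<c) = refl

walksUp-to-top : ∀ c y p k → suc y ≡ c → walksUp c y p k ≡ atPred p (λ p′ → walks c (suc y) p′ k)
walksUp-to-top .(suc y) y p k refl rewrite <ᵇ-true (n<1+n y) | ≡ᵇ-true {y} refl = refl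

walksUp-outside : ∀ c y p k → c ≤ y → walksUp c y p k ≡ 0
walksUp-outside c y p k c≤y rewrite <ᵇ-false c≤y = refl

walks-from-top : ∀ c p k → walks (suc c) (suc c) p k ≡ walks (suc c) c p k
walks-from-top c p zero    = refl
walks-from-top c p (suc k) = trans (cong (walks (suc c) c p (suc k) +_) (walksUp-outside (suc c) (suc c) p k ≤-refl))
                                   (+-identityʳ _)

-- Deleting the excursions c → c + 1 → c from a walk in [0, c + 1] leaves a walk in [0, c];
-- conversely the p excursions can be inserted at any of its q arrivals at c, and also at the
-- start when y = c: in multichoose q p, resp. multichoose (q + 1) p = lattice q p, ways.

walks-lift     : ∀ K c y p k → K ≡ p + k → y < c →
                 walks (suc c) y p K ≡ ∑[ q < suc k ] (multichoose q p * walks c y q k)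
walksUp-lift   : ∀ K c y p k → K ≡ p + k → y < c →
                 walks (suc c) (suc y) p K ≡ ∑[ q < suc (suc k) ] (multichoose q p * walksUp c y q k)
walks-lift-top : ∀ K c p k → K ≡ p + k →
                 walks (suc c) c p K ≡ ∑[ q < suc k ] (lattice q p * walks c c q k)

walks-lift zero    c zero    zero    zero    _ _ = refl
walks-lift zero    c y       zero    (suc k) () _
walks-lift zero    c y       (suc p) k       () _
walks-lift (suc K) c zero    zero    zero    () _
walks-lift (suc K) c zero    (suc p) zero    e y<c =
  trans (walksUp-inner (suc c) 0 (suc p) K (s≤s y<c))
        (walks-vanish (suc c) 1 (suc p) K (≤-reflexive (trans e (+-identityʳ (suc p)))))
walks-lift (suc K) c zero    p       (suc k) e y<c =
  trans (walksUp-inner (suc c) 0 p K (s≤s y<c)) (walksUp-lift K c 0 p k (suc-injective (trans e (+-suc p k))) y<c)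
walks-lift zero    c (suc y) zero    zero    e y<c = walks-lift zero c y zero zero e (<-trans (n<1+n y) y<c)
walks-lift (suc K) c (suc y) p       zero    e y<c = begin
  walks (suc c) y p (suc K) + walksUp (suc c) (suc y) p K
    ≡⟨ cong₂ _+_ (walks-lift (suc K) c y p zero e (<-trans (n<1+n y) y<c)) up≡0 ⟩
  multichoose 0 p * walks c y 0 0 + 0 + 0
    ≡⟨ +-identityʳ _ ⟩
  multichoose 0 p * walks c y 0 0 + 0 ∎
  where
  up≡0 : walksUp (suc c) (suc y) p K ≡ 0
  up≡0 = trans (walksUp-inner (suc c) (suc y) p K (s≤s y<c))
               (walks-vanish (suc c) (suc (suc y)) p K (≤-reflexive (trans e (+-identityʳ p))))
walks-lift (suc K) c (suc y) p       (suc k) e y<c = begin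
  walks (suc c) y p (suc K) + walksUp (suc c) (suc y) p K
    ≡⟨ cong₂ _+_ (walks-lift (suc K) c y p (suc k) e (<-trans (n<1+n y) y<c))
                 (trans (walksUp-inner (suc c) (suc y) p K (s≤s y<c))
                        (walksUp-lift K c (suc y) p k (suc-injective (trans e (+-suc p k))) y<c)) ⟩
  ∑[ q < suc (suc k) ] (multichoose q p * walks c y q (suc k))
    + ∑[ q < suc (suc k) ] (multichoose q p * walksUp c (suc y) q k)
    ≡⟨ ∑-*-+ˡ (suc (suc k)) (λ q → multichoose q p) (λ q → walks c y q (suc k)) (λ q → walksUp c (suc y) q k) ⟩
  ∑[ q < suc (suc k) ] (multichoose q p * walks c (suc y) q (suc k)) ∎

walksUp-lift K c y p k e y<c with <-cmp (suc y) c
... | tri< y+1<c _ _ = begin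
  walks (suc c) (suc y) p K
    ≡⟨ walks-lift K c (suc y) p k e y+1<c ⟩
  ∑[ q < suc k ] (multichoose q p * walks c (suc y) q k)
    ≡⟨ ∑-trailing-zeros (suc k) (suc (suc k)) (n≤1+n _) beyond-k ⟨
  ∑[ q < suc (suc k) ] (multichoose q p * walks c (suc y) q k)
    ≡⟨ ∑-cong (suc (suc k)) (λ q _ → cong (multichoose q p *_) (walksUp-inner c y q k y+1<c)) ⟨
  ∑[ q < suc (suc k) ] (multichoose q p * walksUp c y q k) ∎
  where
  beyond-k : ∀ q → suc k ≤ q → q < suc (suc k) → multichoose q p * walks c (suc y) q k ≡ 0
  beyond-k q k<q _ = trans (cong (multichoose q p *_) (walks-vanish c (suc y) q k k<q)) (*-zeroʳ (multichoose q p))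
... | tri≈ _ refl _ = begin
  walks (suc (suc y)) (suc y) p K
    ≡⟨ walks-lift-top K (suc y) p k e ⟩
  ∑[ q < suc k ] (lattice q p * walks (suc y) (suc y) q k)
    ≡⟨ cong (_+ ∑[ q < suc k ] (lattice q p * walks (suc y) (suc y) q k)) (*-zeroʳ (multichoose 0 p)) ⟨
  ∑[ q < suc (suc k) ] (multichoose q p * atPred q (λ q′ → walks (suc y) (suc y) q′ k))
    ≡⟨ ∑-cong (suc (suc k)) (λ q _ → cong (multichoose q p *_) (walksUp-to-top (suc y) y q k refl)) ⟨
  ∑[ q < suc (suc k) ] (multichoose q p * walksUp (suc y) y q k) ∎
... | tri> _ _ c<y+1 = ⊥-elim (<-irrefl refl (≤-trans c<y+1 y<c))

walks-lift-top zero    zero    zero     zero    _ = refl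
walks-lift-top zero    c       zero     (suc k) ()
walks-lift-top zero    c       (suc p)  k       ()
walks-lift-top (suc K) zero    zero     k       e =
  trans (walksUp-to-top 1 0 0 K refl) (sym (∑-zero (suc k) (λ q _ → no-up-steps q k e)))
  where
  no-up-steps : ∀ q k → suc K ≡ k → lattice q 0 * walks 0 0 q k ≡ 0
  no-up-steps q (suc k) _ = refl
walks-lift-top (suc K) zero    (suc p)  k       e = begin
  walksUp 1 0 (suc p) K
    ≡⟨ trans (walksUp-to-top 1 0 (suc p) K refl) (walks-from-top 0 p K) ⟩
  walks 1 0 p K
    ≡⟨ walks-lift-top K 0 p k (suc-injective e) ⟩
  ∑[ q < suc k ] (lattice q p * walks 0 0 q k)
    ≡⟨ cong (_+ ∑[ q < suc k ] (lattice q p * walks 0 0 q k)) (∑-zero (suc k) never-top) ⟨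
  ∑[ q < suc k ] (multichoose q (suc p) * walks 0 0 q k) + ∑[ q < suc k ] (lattice q p * walks 0 0 q k)
    ≡⟨ ∑-+-*ʳ (suc k) (λ q → multichoose q (suc p)) (λ q → lattice q p) (λ q → walks 0 0 q k) ⟩
  ∑[ q < suc k ] ((multichoose q (suc p) + lattice q p) * walks 0 0 q k)
    ≡⟨ ∑-cong (suc k) (λ q _ → cong (_* walks 0 0 q k) (lattice-split q p)) ⟨
  ∑[ q < suc k ] (lattice q (suc p) * walks 0 0 q k) ∎
  where
  never-top : ∀ q → q < suc k → multichoose q (suc p) * walks 0 0 q k ≡ 0
  never-top zero    _ = refl
  never-top (suc q) _ = trans (cong (lattice q (suc p) *_) (at-zero q k)) (*-zeroʳ (lattice q (suc p)))
    where
    at-zero : ∀ q k → walks 0 0 (suc q) k ≡ 0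
    at-zero q zero    = refl
    at-zero q (suc k) = refl
walks-lift-top zero    (suc c) zero     zero    e = walks-lift zero (suc c) c zero zero e (n<1+n c)
walks-lift-top (suc K) (suc c) zero     k       e = begin
  walks (suc (suc c)) c 0 (suc K) + walksUp (suc (suc c)) (suc c) 0 K
    ≡⟨ cong₂ _+_ (walks-lift (suc K) (suc c) c 0 k e (n<1+n c)) (walksUp-to-top (suc (suc c)) (suc c) 0 K refl) ⟩
  ∑[ q < suc k ] (multichoose q 0 * walks (suc c) c q k) + 0
    ≡⟨ +-identityʳ _ ⟩
  ∑[ q < suc k ] (multichoose q 0 * walks (suc c) c q k)
    ≡⟨ ∑-cong (suc k) (λ q _ → cong₂ _*_ (multichoose-zeroʳ q) (sym (walks-from-top c q k))) ⟩
  ∑[ q < suc k ] (lattice q 0 * walks (suc c) (suc c) q k) ∎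
walks-lift-top (suc K) (suc c) (suc p)  k       e = begin
  walks (suc (suc c)) c (suc p) (suc K) + walksUp (suc (suc c)) (suc c) (suc p) K
    ≡⟨ cong₂ _+_ (walks-lift (suc K) (suc c) c (suc p) k e (n<1+n c))
                 (trans (walksUp-to-top (suc (suc c)) (suc c) (suc p) K refl)
                        (trans (walks-from-top (suc c) p K) (walks-lift-top K (suc c) p k (suc-injective e)))) ⟩
  ∑[ q < suc k ] (multichoose q (suc p) * walks (suc c) c q k)
    + ∑[ q < suc k ] (lattice q p * walks (suc c) (suc c) q k)
    ≡⟨ cong (_+ ∑[ q < suc k ] (lattice q p * walks (suc c) (suc c) q k))
            (∑-cong (suc k) (λ q _ → cong (multichoose q (suc p) *_) (walks-from-top c q k))) ⟨
  ∑[ q < suc k ] (multichoose q (suc p) * walks (suc c) (suc c) q k)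
    + ∑[ q < suc k ] (lattice q p * walks (suc c) (suc c) q k)
    ≡⟨ ∑-+-*ʳ (suc k) (λ q → multichoose q (suc p)) (λ q → lattice q p) (λ q → walks (suc c) (suc c) q k) ⟩
  ∑[ q < suc k ] ((multichoose q (suc p) + lattice q p) * walks (suc c) (suc c) q k)
    ≡⟨ ∑-cong (suc k) (λ q _ → cong (_* walks (suc c) (suc c) q k) (lattice-split q p)) ⟨
  ∑[ q < suc k ] (lattice q (suc p) * walks (suc c) (suc c) q k) ∎

-- A rushed Dyck path of semilength n + 1 whose initial run has c + 1 up-steps continues
-- with a walk from c down to 0 inside [0, c] having n ∸ c up-steps; rushedReturns q n counts
-- those paths which return to altitude c exactly q times.

rushedReturns : ℕ → ℕ → ℕ
rushedReturns q n = ∑[ c < suc n ] walks c c q (n ∸ c)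

rushedReturns-vanish : ∀ q n → suc n ≤ q → rushedReturns q (suc n) ≡ 0
rushedReturns-vanish q n n<q =
  ∑-zero (suc n) (λ c _ → walks-vanish (suc c) (suc c) q (n ∸ c) (≤-trans (s≤s (m∸n≤m n c)) n<q))

rushedReturns-recurrence : ∀ d r → rushedReturns d (suc (d + r)) ≡ ∑[ s < suc r ] (lattice d s * rushedReturns s r)
rushedReturns-recurrence d r = begin
  ∑[ c < suc (d + r) ] walks (suc c) (suc c) d (d + r ∸ c)
    ≡⟨ ∑-trailing-zeros (suc r) (suc (d + r)) (s≤s (m≤n+m r d)) too-high ⟩
  ∑[ c < suc r ] walks (suc c) (suc c) d (d + r ∸ c)
    ≡⟨ ∑-cong (suc r) lift ⟩
  ∑[ c < suc r ] ∑[ s < suc r ] (lattice d s * walks c c s (r ∸ c))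
    ≡⟨ ∑-comm (suc r) (suc r) (λ c s → lattice d s * walks c c s (r ∸ c)) ⟩
  ∑[ s < suc r ] ∑[ c < suc r ] (lattice d s * walks c c s (r ∸ c))
    ≡⟨ ∑-cong (suc r) (λ s _ → *-distribˡ-∑ (suc r) (lattice d s) (λ c → walks c c s (r ∸ c))) ⟩
  ∑[ s < suc r ] (lattice d s * rushedReturns s r) ∎
  where
  too-high : ∀ c → suc r ≤ c → c < suc (d + r) → walks (suc c) (suc c) d (d + r ∸ c) ≡ 0
  too-high c r<c c≤d+r = walks-vanish (suc c) (suc c) d (d + r ∸ c)
    (+-cancelʳ-< c (d + r ∸ c) d (subst (_< d + c) (sym (m∸n+n≡m (≤-pred c≤d+r))) (+-monoʳ-< d r<c)))
  lift : ∀ c → c < suc r → walks (suc c) (suc c) d (d + r ∸ c) ≡ ∑[ s < suc r ] (lattice d s * walks c c s (r ∸ c))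
  lift c (s≤s c≤r) = begin
    walks (suc c) (suc c) d (d + r ∸ c)
      ≡⟨ walks-from-top c d _ ⟩
    walks (suc c) c d (d + r ∸ c)
      ≡⟨ walks-lift-top (d + r ∸ c) c d (r ∸ c) (+-∸-assoc d c≤r) ⟩
    ∑[ s < suc (r ∸ c) ] (lattice s d * walks c c s (r ∸ c))
      ≡⟨ ∑-trailing-zeros (suc (r ∸ c)) (suc r) (s≤s (m∸n≤m r c)) beyond ⟨
    ∑[ s < suc r ] (lattice s d * walks c c s (r ∸ c))
      ≡⟨ ∑-cong (suc r) (λ s _ → cong (_* walks c c s (r ∸ c)) (lattice-sym s d)) ⟩
    ∑[ s < suc r ] (lattice d s * walks c c s (r ∸ c)) ∎
    where
    beyond : ∀ s → suc (r ∸ c) ≤ s → s < suc r → lattice s d * walks c c s (r ∸ c) ≡ 0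
    beyond s r∸c<s _ = trans (cong (lattice s d *_) (walks-vanish c c s (r ∸ c) r∸c<s)) (*-zeroʳ (lattice s d))

∑children : (ℕ → ℕ → ℕ) → ℕ → ℕ → ℕ
∑children g a d = g d 0 + ∑[ i < suc a ] g i (suc d)

tree : ℕ → ℕ → ℕ → ℕ
tree zero    a d = 1
tree (suc r) a d = ∑children (tree r) a d

tree-rushedReturns : ∀ r a d → tree r a d ≡ ∑[ t < suc r ] (lattice a t * rushedReturns (d + t) (suc (d + r)))
tree-rushedReturns zero    a d = begin
  1                                              ≡⟨ rushedReturns-recurrence d 0 ⟨
  rushedReturns d (suc (d + 0))                  ≡⟨ cong (λ e → rushedReturns e (suc (d + 0))) (+-identityʳ d) ⟨
  rushedReturns (d + 0) (suc (d + 0))            ≡⟨ +-identityʳ _ ⟨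
  rushedReturns (d + 0) (suc (d + 0)) + 0        ≡⟨ +-identityʳ _ ⟨
  rushedReturns (d + 0) (suc (d + 0)) + 0 + 0    ∎
tree-rushedReturns (suc r) a d = begin
  tree r d 0 + ∑[ i < suc a ] tree r i (suc d)
    ≡⟨ cong₂ _+_ (tree-rushedReturns r d 0) (∑-cong (suc a) (λ i _ → tree-rushedReturns r i (suc d))) ⟩
  ∑[ t < suc r ] (lattice d t * rushedReturns t (suc r))
    + ∑[ i < suc a ] ∑[ t < suc r ] (lattice i t * rushedReturns (suc d + t) (suc (suc d + r)))
    ≡⟨ cong₂ _+_ new-maximum old-maximum ⟩
  lattice a 0 * rushedReturns (d + 0) (suc (d + suc r))
    + ∑[ t < suc r ] (lattice a (suc t) * rushedReturns (d + suc t) (suc (d + suc r))) ∎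
  where
  new-maximum : ∑[ t < suc r ] (lattice d t * rushedReturns t (suc r)) ≡ lattice a 0 * rushedReturns (d + 0) (suc (d + suc r))
  new-maximum = begin
    ∑[ t < suc r ] (lattice d t * rushedReturns t (suc r))
      ≡⟨ +-identityʳ _ ⟨
    ∑[ t < suc r ] (lattice d t * rushedReturns t (suc r)) + 0
      ≡⟨ cong (∑[ t < suc r ] (lattice d t * rushedReturns t (suc r)) +_)
              (trans (cong (lattice d (suc r) *_) (rushedReturns-vanish (suc r) r ≤-refl)) (*-zeroʳ (lattice d (suc r)))) ⟨
    ∑[ t < suc r ] (lattice d t * rushedReturns t (suc r)) + lattice d (suc r) * rushedReturns (suc r) (suc r)
      ≡⟨ ∑-last (suc r) (λ t → lattice d t * rushedReturns t (suc r)) ⟨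
    ∑[ t < suc (suc r) ] (lattice d t * rushedReturns t (suc r))
      ≡⟨ rushedReturns-recurrence d (suc r) ⟨
    rushedReturns d (suc (d + suc r))
      ≡⟨ cong (λ e → rushedReturns e (suc (d + suc r))) (+-identityʳ d) ⟨
    rushedReturns (d + 0) (suc (d + suc r))
      ≡⟨ *-identityˡ _ ⟨
    lattice a 0 * rushedReturns (d + 0) (suc (d + suc r)) ∎
  old-maximum : ∑[ i < suc a ] ∑[ t < suc r ] (lattice i t * rushedReturns (suc d + t) (suc (suc d + r)))
              ≡ ∑[ t < suc r ] (lattice a (suc t) * rushedReturns (d + suc t) (suc (d + suc r)))
  old-maximum = begin
    ∑[ i < suc a ] ∑[ t < suc r ] (lattice i t * rushedReturns (suc d + t) (suc (suc d + r)))
      ≡⟨ ∑-comm (suc a) (suc r) (λ i t → lattice i t * rushedReturns (suc d + t) (suc (suc d + r))) ⟩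
    ∑[ t < suc r ] ∑[ i < suc a ] (lattice i t * rushedReturns (suc d + t) (suc (suc d + r)))
      ≡⟨ ∑-cong (suc r) (λ t _ → *-distribʳ-∑ (suc a) (rushedReturns (suc d + t) (suc (suc d + r))) (λ i → lattice i t)) ⟩
    ∑[ t < suc r ] (∑[ i < suc a ] lattice i t * rushedReturns (suc d + t) (suc (suc d + r)))
      ≡⟨ ∑-cong (suc r) (λ t _ → cong₂ _*_ (hockey-stick a t)
                                          (cong₂ rushedReturns (sym (+-suc d t)) (cong suc (sym (+-suc d r))))) ⟩
    ∑[ t < suc r ] (lattice a (suc t) * rushedReturns (d + suc t) (suc (d + suc r))) ∎

rushedTotal : ℕ → ℕ
rushedTotal n = ∑[ c < suc n ] ∑[ p < suc (n ∸ c) ] walks c c p (n ∸ c)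

rushedTotal≡tree : ∀ m → rushedTotal (suc m) ≡ tree m 0 0
rushedTotal≡tree m = begin
  ∑[ c < suc n ] ∑[ p < suc (n ∸ c) ] walks c c p (n ∸ c)
    ≡⟨ ∑-cong (suc n) (λ c _ → ∑-trailing-zeros (suc (n ∸ c)) (suc n) (s≤s (m∸n≤m n c))
                                                 (λ p n∸c<p _ → walks-vanish c c p (n ∸ c) n∸c<p)) ⟨
  ∑[ c < suc n ] ∑[ p < suc n ] walks c c p (n ∸ c)
    ≡⟨ ∑-comm (suc n) (suc n) (λ c p → walks c c p (n ∸ c)) ⟩
  ∑[ p < suc n ] rushedReturns p n
    ≡⟨ ∑-last n (λ p → rushedReturns p n) ⟩
  ∑[ p < n ] rushedReturns p n + rushedReturns n n
    ≡⟨ cong (∑[ p < n ] rushedReturns p n +_) (rushedReturns-vanish n m ≤-refl) ⟩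
  ∑[ p < n ] rushedReturns p n + 0
    ≡⟨ +-identityʳ _ ⟩
  ∑[ p < n ] rushedReturns p n
    ≡⟨ ∑-cong n (λ t _ → trans (cong (_* rushedReturns t n) (lattice-zeroˡ t)) (*-identityˡ _)) ⟨
  ∑[ t < n ] (lattice 0 t * rushedReturns t n)
    ≡⟨ tree-rushedReturns m 0 0 ⟨
  tree m 0 0 ∎
  where
  n = suc m

-- Rushed Dyck paths as words

∑-allWords-suc : ∀ k (f : List Bool → ℕ) →
                 ∑[ s ∈ allWords (suc k) ] f s ≡ ∑[ s ∈ allWords k ] f (true ∷ s) + ∑[ s ∈ allWords k ] f (false ∷ s)
∑-allWords-suc k f = begin
  ∑∈ (map (true ∷_) (allWords k) ++ map (false ∷_) (allWords k)) f
    ≡⟨ ∑∈-++ (map (true ∷_) (allWords k)) (map (false ∷_) (allWords k)) f ⟩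
  ∑∈ (map (true ∷_) (allWords k)) f + ∑∈ (map (false ∷_) (allWords k)) f
    ≡⟨ cong₂ _+_ (∑∈-map (true ∷_) (allWords k) f) (∑∈-map (false ∷_) (allWords k) f) ⟩
  ∑[ s ∈ allWords k ] f (true ∷ s) + ∑[ s ∈ allWords k ] f (false ∷ s) ∎

stripWalk : ℕ → ℕ → List Bool → Bool
stripWalk c y s = dyckFrom y s ∧ neverVisits (suc c) y s

stripWalk-up : ∀ c y s → y < c → stripWalk c y (true ∷ s) ≡ stripWalk c (suc y) s
stripWalk-up c y s y<c rewrite ≡ᵇ-false (<⇒≢ y<c) = refl

stripWalk-up-top : ∀ c s → stripWalk c c (true ∷ s) ≡ false
stripWalk-up-top c s rewrite ≡ᵇ-true {c} refl = ∧-zeroʳ _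

stripWalk-down : ∀ c y s → y ≤ c → stripWalk c (suc y) (false ∷ s) ≡ stripWalk c y s
stripWalk-down c y s y≤c rewrite ≡ᵇ-false (<⇒≢ (s≤s y≤c)) = refl

stripPaths   : ℕ → ℕ → ℕ → ℕ
stripPathsUp : ℕ → ℕ → ℕ → ℕ
stripPaths c zero    zero    = 1
stripPaths c (suc y) zero    = 0
stripPaths c zero    (suc ℓ) = stripPathsUp c zero ℓ
stripPaths c (suc y) (suc ℓ) = stripPaths c y ℓ + stripPathsUp c (suc y) ℓ
stripPathsUp c y ℓ = if y <ᵇ c then stripPaths c (suc y) ℓ else 0

stripPathsUp-inner : ∀ c y ℓ → y < c → stripPathsUp c y ℓ ≡ stripPaths c (suc y) ℓ
stripPathsUp-inner c y ℓ y<c rewrite <ᵇ-true y<c = refl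

stripPathsUp-outside : ∀ c y ℓ → c ≤ y → stripPathsUp c y ℓ ≡ 0
stripPathsUp-outside c y ℓ c≤y rewrite <ᵇ-false c≤y = refl

count-stripWalk   : ∀ ℓ c y → y ≤ c → ∑[ s ∈ allWords ℓ ] 𝟙 (stripWalk c y s) ≡ stripPaths c y ℓ
count-stripWalkUp : ∀ ℓ c y → y ≤ c → ∑[ s ∈ allWords ℓ ] 𝟙 (stripWalk c y (true ∷ s)) ≡ stripPathsUp c y ℓ

count-stripWalk zero    c zero    _   = refl
count-stripWalk zero    c (suc y) _   = refl
count-stripWalk (suc ℓ) c zero    _   = begin
  ∑[ s ∈ allWords (suc ℓ) ] 𝟙 (stripWalk c 0 s)
    ≡⟨ ∑-allWords-suc ℓ (𝟙 ∘ stripWalk c 0) ⟩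
  ∑[ s ∈ allWords ℓ ] 𝟙 (stripWalk c 0 (true ∷ s)) + ∑[ s ∈ allWords ℓ ] 0
    ≡⟨ cong₂ _+_ (count-stripWalkUp ℓ c 0 z≤n) (∑∈-zero (allWords ℓ) (λ _ → refl)) ⟩
  stripPathsUp c 0 ℓ + 0
    ≡⟨ +-identityʳ _ ⟩
  stripPathsUp c 0 ℓ ∎
count-stripWalk (suc ℓ) c (suc y) y<c = begin
  ∑[ s ∈ allWords (suc ℓ) ] 𝟙 (stripWalk c (suc y) s)
    ≡⟨ ∑-allWords-suc ℓ (𝟙 ∘ stripWalk c (suc y)) ⟩
  ∑[ s ∈ allWords ℓ ] 𝟙 (stripWalk c (suc y) (true ∷ s)) + ∑[ s ∈ allWords ℓ ] 𝟙 (stripWalk c (suc y) (false ∷ s))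
    ≡⟨ +-comm (∑[ s ∈ allWords ℓ ] 𝟙 (stripWalk c (suc y) (true ∷ s))) _ ⟩
  ∑[ s ∈ allWords ℓ ] 𝟙 (stripWalk c (suc y) (false ∷ s)) + ∑[ s ∈ allWords ℓ ] 𝟙 (stripWalk c (suc y) (true ∷ s))
    ≡⟨ cong₂ _+_ (trans (∑∈-cong-≗ (allWords ℓ) (λ s → cong 𝟙 (stripWalk-down c y s (<⇒≤ y<c))))
                        (count-stripWalk ℓ c y (<⇒≤ y<c)))
                 (count-stripWalkUp ℓ c (suc y) y<c) ⟩
  stripPaths c y ℓ + stripPathsUp c (suc y) ℓ ∎

count-stripWalkUp ℓ c y y≤c with m≤n⇒m<n∨m≡n y≤c
... | inj₁ y<c = begin
  ∑[ s ∈ allWords ℓ ] 𝟙 (stripWalk c y (true ∷ s))   ≡⟨ ∑∈-cong-≗ (allWords ℓ) (λ s → cong 𝟙 (stripWalk-up c y s y<c)) ⟩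
  ∑[ s ∈ allWords ℓ ] 𝟙 (stripWalk c (suc y) s)      ≡⟨ count-stripWalk ℓ c (suc y) y<c ⟩
  stripPaths c (suc y) ℓ                              ≡⟨ stripPathsUp-inner c y ℓ y<c ⟨
  stripPathsUp c y ℓ                                  ∎
... | inj₂ refl = trans (∑∈-zero (allWords ℓ) (λ s → cong 𝟙 (stripWalk-up-top y s)))
                        (sym (stripPathsUp-outside y y ℓ ≤-refl))

stripPaths-vanish : ∀ ℓ c y → ℓ < y → stripPaths c y ℓ ≡ 0
stripPaths-vanish zero    c (suc y) _          = refl
stripPaths-vanish (suc ℓ) c (suc y) (s≤s ℓ<y) = cong₂ _+_ (stripPaths-vanish ℓ c y ℓ<y) up≡0
  where
  up≡0 : stripPathsUp c (suc y) ℓ ≡ 0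
  up≡0 with suc y <ᵇ c
  ... | true  = stripPaths-vanish ℓ c (suc (suc y)) (m<n⇒m<1+n (m<n⇒m<1+n ℓ<y))
  ... | false = refl

stripPaths-walks   : ∀ k c y ℓ → ℓ ≡ y + (k + k) → stripPaths c y ℓ ≡ ∑[ p < suc k ] walks c y p k
stripPathsUp-walks : ∀ k c y ℓ → ℓ ≡ suc y + (k + k) → stripPathsUp c y ℓ ≡ ∑[ p < suc (suc k) ] walksUp c y p k

stripPaths-walks zero    c zero    .0       refl = refl
stripPaths-walks zero    c (suc y) (suc ℓ) e    = begin
  stripPaths c y ℓ + stripPathsUp c (suc y) ℓ ≡⟨ cong₂ _+_ (stripPaths-walks zero c y ℓ (suc-injective e)) up≡0 ⟩
  walks c y 0 0 + 0 + 0                         ≡⟨ +-identityʳ _ ⟩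
  walks c y 0 0 + 0                             ∎
  where
  up≡0 : stripPathsUp c (suc y) ℓ ≡ 0
  up≡0 with suc y <ᵇ c
  ... | true  = stripPaths-vanish ℓ c (suc (suc y)) (m<n⇒m<1+n (s≤s (≤-reflexive (trans (suc-injective e) (+-identityʳ y)))))
  ... | false = refl
stripPaths-walks (suc k) c zero    (suc ℓ) e    =
  stripPathsUp-walks k c 0 ℓ (trans (suc-injective e) (+-suc k k))
stripPaths-walks (suc k) c (suc y) (suc ℓ) e    = begin
  stripPaths c y ℓ + stripPathsUp c (suc y) ℓ
    ≡⟨ cong₂ _+_ (stripPaths-walks (suc k) c y ℓ (suc-injective e))
                 (stripPathsUp-walks k c (suc y) ℓ (trans (suc-injective e) (length-shift y k))) ⟩
  ∑[ p < suc (suc k) ] walks c y p (suc k) + ∑[ p < suc (suc k) ] walksUp c (suc y) p k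
    ≡⟨ ∑-distrib-+ (suc (suc k)) (λ p → walks c y p (suc k)) (λ p → walksUp c (suc y) p k) ⟨
  ∑[ p < suc (suc k) ] walks c (suc y) p (suc k) ∎
  where
  length-shift : ∀ y k → y + (suc k + suc k) ≡ suc (suc y) + (k + k)
  length-shift = solve-∀

stripPathsUp-walks k c y ℓ e with <-cmp (suc y) c
... | tri< y+1<c _ _ = begin
  stripPathsUp c y ℓ
    ≡⟨ stripPathsUp-inner c y ℓ (<-trans (n<1+n y) y+1<c) ⟩
  stripPaths c (suc y) ℓ
    ≡⟨ stripPaths-walks k c (suc y) ℓ e ⟩
  ∑[ p < suc k ] walks c (suc y) p k
    ≡⟨ ∑-trailing-zeros (suc k) (suc (suc k)) (n≤1+n _) (λ p k<p _ → walks-vanish c (suc y) p k k<p) ⟨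
  ∑[ p < suc (suc k) ] walks c (suc y) p k
    ≡⟨ ∑-cong (suc (suc k)) (λ p _ → walksUp-inner c y p k y+1<c) ⟨
  ∑[ p < suc (suc k) ] walksUp c y p k ∎
... | tri≈ _ refl _ = begin
  stripPathsUp (suc y) y ℓ
    ≡⟨ stripPathsUp-inner (suc y) y ℓ (n<1+n y) ⟩
  stripPaths (suc y) (suc y) ℓ
    ≡⟨ stripPaths-walks k (suc y) (suc y) ℓ e ⟩
  ∑[ p < suc k ] walks (suc y) (suc y) p k
    ≡⟨ ∑-cong (suc (suc k)) (λ p _ → walksUp-to-top (suc y) y p k refl) ⟨
  ∑[ p < suc (suc k) ] walksUp (suc y) y p k ∎
... | tri> _ _ c<y+1 = trans (stripPathsUp-outside c y ℓ (≤-pred c<y+1))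
  (sym (∑-zero (suc (suc k)) (λ p _ → walksUp-outside c y p k (≤-pred c<y+1))))

rushedTail : ℕ → List Bool → Bool
rushedTail zero    r = false
rushedTail (suc k) r = neverVisits (suc k) (suc k) r

isRushed-leadUps : ∀ s → isRushed s ≡ rushedTail (proj₁ (leadUps s)) (proj₂ (leadUps s))
isRushed-leadUps s with leadUps s
... | zero  , r = refl
... | suc k , r = refl

leadUps-up : ∀ s → leadUps (true ∷ s) ≡ (suc (proj₁ (leadUps s)) , proj₂ (leadUps s))
leadUps-up s with leadUps s
... | k , r = refl

-- rushedAfter h s: h up-steps followed by s form a rushed Dyck path.

rushedAfter : ℕ → List Bool → Bool
rushedAfter h       []          = false
rushedAfter h       (true ∷ s)  = rushedAfter (suc h) s
rushedAfter zero    (false ∷ s) = false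
rushedAfter (suc c) (false ∷ s) = stripWalk c c s

rushedAfter-spec : ∀ h s → (dyckFrom h s ∧ rushedTail (h + proj₁ (leadUps s)) (proj₂ (leadUps s))) ≡ rushedAfter h s
rushedAfter-spec zero    []          = refl
rushedAfter-spec (suc h) []          = refl
rushedAfter-spec h       (true ∷ s)  rewrite leadUps-up s | +-suc h (proj₁ (leadUps s)) = rushedAfter-spec (suc h) s
rushedAfter-spec zero    (false ∷ s) = refl
rushedAfter-spec (suc c) (false ∷ s) rewrite +-identityʳ c | ≡ᵇ-false (<⇒≢ (n<1+n c)) = refl

rushedDyck≡rushedAfter : ∀ s → (isDyck s ∧ isRushed s) ≡ rushedAfter 0 s
rushedDyck≡rushedAfter s rewrite isRushed-leadUps s = rushedAfter-spec 0 s

count-rushedAfter : ∀ k c → ∑[ s ∈ allWords k ] 𝟙 (rushedAfter (suc c) s) ≡ ∑[ j < k ] stripPaths (c + j) (c + j) (k ∸ suc j)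
count-rushedAfter zero    c = refl
count-rushedAfter (suc k) c = begin
  ∑[ s ∈ allWords (suc k) ] 𝟙 (rushedAfter (suc c) s)
    ≡⟨ ∑-allWords-suc k (𝟙 ∘ rushedAfter (suc c)) ⟩
  ∑[ s ∈ allWords k ] 𝟙 (rushedAfter (suc (suc c)) s) + ∑[ s ∈ allWords k ] 𝟙 (stripWalk c c s)
    ≡⟨ cong₂ _+_ (count-rushedAfter k (suc c)) (count-stripWalk k c c ≤-refl) ⟩
  ∑[ j < k ] stripPaths (suc c + j) (suc c + j) (k ∸ suc j) + stripPaths c c k
    ≡⟨ +-comm _ (stripPaths c c k) ⟩
  stripPaths c c k + ∑[ j < k ] stripPaths (suc c + j) (suc c + j) (k ∸ suc j)
    ≡⟨ cong₂ _+_ (cong (λ e → stripPaths e e k) (+-identityʳ c))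
                 (∑-cong k (λ j _ → cong (λ e → stripPaths e e (k ∸ suc j)) (+-suc c j))) ⟨
  stripPaths (c + 0) (c + 0) k + ∑[ j < k ] stripPaths (c + suc j) (c + suc j) (k ∸ suc j) ∎

countRushed-stripPaths : ∀ n → countRushed (suc n) ≡ ∑[ c < suc (n + n) ] stripPaths c c (n + n ∸ c)
countRushed-stripPaths n = begin
  length (filterᵇ (λ s → isDyck s ∧ isRushed s) (allWords (suc n + suc n)))
    ≡⟨ length-filterᵇ (λ s → isDyck s ∧ isRushed s) (allWords (suc n + suc n)) ⟩
  ∑[ s ∈ allWords (suc n + suc n) ] 𝟙 (isDyck s ∧ isRushed s)
    ≡⟨ ∑∈-cong-≗ (allWords (suc n + suc n)) (cong 𝟙 ∘ rushedDyck≡rushedAfter) ⟩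
  ∑[ s ∈ allWords (suc (n + suc n)) ] 𝟙 (rushedAfter 0 s)
    ≡⟨ ∑-allWords-suc (n + suc n) (𝟙 ∘ rushedAfter 0) ⟩
  ∑[ s ∈ allWords (n + suc n) ] 𝟙 (rushedAfter 1 s) + ∑[ s ∈ allWords (n + suc n) ] 0
    ≡⟨ cong₂ _+_ (cong (λ ℓ → ∑[ s ∈ allWords ℓ ] 𝟙 (rushedAfter 1 s)) (+-suc n n))
                 (∑∈-zero (allWords (n + suc n)) (λ _ → refl)) ⟩
  ∑[ s ∈ allWords (suc (n + n)) ] 𝟙 (rushedAfter 1 s) + 0
    ≡⟨ +-identityʳ _ ⟩
  ∑[ s ∈ allWords (suc (n + n)) ] 𝟙 (rushedAfter 1 s)
    ≡⟨ count-rushedAfter (suc (n + n)) 0 ⟩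
  ∑[ c < suc (n + n) ] stripPaths c c (n + n ∸ c) ∎

∑-stripPaths≡rushedTotal : ∀ n → ∑[ c < suc (n + n) ] stripPaths c c (n + n ∸ c) ≡ rushedTotal n
∑-stripPaths≡rushedTotal n = begin
  ∑[ c < suc (n + n) ] stripPaths c c (n + n ∸ c)
    ≡⟨ ∑-trailing-zeros (suc n) (suc (n + n)) (s≤s (m≤m+n n n))
                        (λ c n<c c≤2n → stripPaths-vanish (n + n ∸ c) c c (too-long c n<c c≤2n)) ⟩
  ∑[ c < suc n ] stripPaths c c (n + n ∸ c)
    ≡⟨ ∑-cong (suc n) (λ c c≤n → stripPaths-walks (n ∸ c) c c (n + n ∸ c) (length≡ c (≤-pred c≤n))) ⟩
  rushedTotal n ∎
  where
  too-long : ∀ c → suc n ≤ c → c < suc (n + n) → n + n ∸ c < c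
  too-long c n<c c≤2n =
    +-cancelʳ-< c (n + n ∸ c) c (subst (_< c + c) (sym (m∸n+n≡m (≤-pred c≤2n))) (+-mono-< n<c n<c))
  length≡ : ∀ c → c ≤ n → n + n ∸ c ≡ c + (n ∸ c + (n ∸ c))
  length≡ c c≤n = begin
    n + n ∸ c                       ≡⟨ cong (λ m → m + m ∸ c) (m+[n∸m]≡n c≤n) ⟨
    (c + t) + (c + t) ∸ c           ≡⟨ cong (_∸ c) (regroup c t) ⟩
    c + (t + t) + c ∸ c             ≡⟨ m+n∸n≡m (c + (t + t)) c ⟩
    c + (t + t)                     ∎
    where
    t = n ∸ c
    regroup : ∀ c t → (c + t) + (c + t) ≡ c + (t + t) + c
    regroup = solve-∀

countRushed≡rushedTotal : ∀ n → countRushed (suc n) ≡ rushedTotal n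
countRushed≡rushedTotal n = trans (countRushed-stripPaths n) (∑-stripPaths≡rushedTotal n)

-- Pattern occurrences

module _ {A : Set} where

  any-++ : ∀ (g : A → Bool) xs ys → any g (xs ++ ys) ≡ any g xs ∨ any g ys
  any-++ g []       ys = refl
  any-++ g (x ∷ xs) ys = trans (cong (g x ∨_) (any-++ g xs ys)) (sym (∨-assoc (g x) (any g xs) (any g ys)))

  any-map : ∀ {B : Set} (g : A → Bool) (f : B → A) xs → any g (map f xs) ≡ any (g ∘ f) xs
  any-map g f []       = refl
  any-map g f (x ∷ xs) = cong (g (f x) ∨_) (any-map g f xs)

  any-∨ : ∀ (g h : A → Bool) xs → any (λ x → g x ∨ h x) xs ≡ any g xs ∨ any h xs
  any-∨ g h []       = refl
  any-∨ g h (x ∷ xs) = trans (cong ((g x ∨ h x) ∨_) (any-∨ g h xs)) (∨-interchange (g x) (h x) (any g xs) (any h xs))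

  any-false : ∀ (g : A → Bool) xs → (∀ x → g x ≡ false) → any g xs ≡ false
  any-false g []       g≡false = refl
  any-false g (x ∷ xs) g≡false rewrite g≡false x = any-false g xs g≡false

  All-any-false : ∀ {P : A → Set} (g : A → Bool) {xs} → All P xs → (∀ {x} → P x → g x ≡ false) → any g xs ≡ false
  All-any-false g []         g≡false = refl
  All-any-false g (px ∷ pxs) g≡false rewrite g≡false px = All-any-false g pxs g≡false

  any-true : ∀ (g : A → Bool) {x xs} → x ∈ xs → g x ≡ true → any g xs ≡ true
  any-true g {x} (here refl) gx≡true rewrite gx≡true = refl
  any-true g {xs = y ∷ xs} (there x∈xs) gx≡true = trans (cong (g y ∨_) (any-true g x∈xs gx≡true)) (∨-zeroʳ (g y))

∧-true-projˡ : ∀ {a b} → (a ∧ b) ≡ true → a ≡ true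
∧-true-projˡ {true} _ = refl

∧-true-projʳ : ∀ {a b} → (a ∧ b) ≡ true → b ≡ true
∧-true-projʳ {true} b≡true = b≡true

not-∨ : ∀ a b → not (a ∨ b) ≡ not a ∧ not b
not-∨ true  b = refl
not-∨ false b = refl

anyPair : (ℕ → ℕ → Bool) → List ℕ → Bool
anyPair g []      = false
anyPair g (a ∷ e) = any (g a) e ∨ anyPair g e

anyPair-∨ : ∀ (g h : ℕ → ℕ → Bool) e → anyPair (λ a b → g a b ∨ h a b) e ≡ anyPair g e ∨ anyPair h e
anyPair-∨ g h []      = refl
anyPair-∨ g h (a ∷ e) = trans (cong₂ _∨_ (any-∨ (g a) (h a) e) (anyPair-∨ g h e))
                              (∨-interchange (any (g a) e) (any (h a) e) (anyPair g e) (anyPair h e))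

anyPair-false : ∀ e → anyPair (λ _ _ → false) e ≡ false
anyPair-false []      = refl
anyPair-false (a ∷ e) = cong₂ _∨_ (any-false _ e (λ _ → refl)) (anyPair-false e)

anyPair-snoc : ∀ (g : ℕ → ℕ → Bool) e x → anyPair g (e ++ [ x ]) ≡ anyPair g e ∨ any (λ a → g a x) e
anyPair-snoc g []      x = refl
anyPair-snoc g (a ∷ e) x = begin
  any (g a) (e ++ [ x ]) ∨ anyPair g (e ++ [ x ])
    ≡⟨ cong₂ _∨_ (trans (any-++ (g a) e [ x ]) (cong (any (g a) e ∨_) (∨-identityʳ (g a x)))) (anyPair-snoc g e x) ⟩
  (any (g a) e ∨ g a x) ∨ (anyPair g e ∨ any (λ a′ → g a′ x) e)
    ≡⟨ ∨-interchange (any (g a) e) (g a x) (anyPair g e) _ ⟩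
  (any (g a) e ∨ anyPair g e) ∨ (g a x ∨ any (λ a′ → g a′ x) e) ∎

orderIso-length : ∀ w f → orderIso w f ≡ true → length w ≡ length f
orderIso-length []       []       _   = refl
orderIso-length (x ∷ xs) (u ∷ us) iso = cong suc (orderIso-length xs us (∧-true-projʳ iso))

any-subseqs-snoc : ∀ (g : List ℕ → Bool) e x →
                   any g (subseqs (e ++ [ x ])) ≡ any g (subseqs e) ∨ any (λ w → g (w ++ [ x ])) (subseqs e)
any-subseqs-snoc g []      x with g (x ∷ []) | g []
... | true  | true  = refl
... | true  | false = refl
... | false | true  = refl
... | false | false = refl
any-subseqs-snoc g (a ∷ e) x = begin
  any g (map (a ∷_) S ++ S)
    ≡⟨ any-++ g (map (a ∷_) S) S ⟩
  any g (map (a ∷_) S) ∨ any g S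
    ≡⟨ cong (_∨ any g S) (any-map g (a ∷_) S) ⟩
  any (g ∘ (a ∷_)) S ∨ any g S
    ≡⟨ cong₂ _∨_ (any-subseqs-snoc (g ∘ (a ∷_)) e x) (any-subseqs-snoc g e x) ⟩
  (any (g ∘ (a ∷_)) R ∨ any (λ w → g (a ∷ w ++ [ x ])) R) ∨ (any g R ∨ any (λ w → g (w ++ [ x ])) R)
    ≡⟨ ∨-interchange (any (g ∘ (a ∷_)) R) _ (any g R) _ ⟩
  (any (g ∘ (a ∷_)) R ∨ any g R) ∨ (any (λ w → g (a ∷ w ++ [ x ])) R ∨ any (λ w → g (w ++ [ x ])) R)
    ≡⟨ cong₂ _∨_ (split g) (split (λ w → g (w ++ [ x ]))) ⟨
  any g (subseqs (a ∷ e)) ∨ any (λ w → g (w ++ [ x ])) (subseqs (a ∷ e)) ∎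
  where
  S = subseqs (e ++ [ x ])
  R = subseqs e
  split : ∀ h → any h (subseqs (a ∷ e)) ≡ any (h ∘ (a ∷_)) R ∨ any h R
  split h = trans (any-++ h (map (a ∷_) R) R) (cong (_∨ any h R) (any-map h (a ∷_) R))

module _ (g : List ℕ → Bool) (g-length : ∀ w → g w ≡ true → length w ≡ 3) (x : ℕ) where

  private
    g-false : ∀ w → length w ≢ 3 → g w ≡ false
    g-false w ≢3 = ¬-not (≢3 ∘ g-length w)

    ending-with-three : ∀ a b c e → any (λ w → g (a ∷ b ∷ c ∷ w ++ [ x ])) (subseqs e) ≡ false
    ending-with-three a b c e = any-false _ (subseqs e) too-long
      where
      too-long : ∀ w → g (a ∷ b ∷ c ∷ w ++ [ x ]) ≡ false
      too-long []      = g-false _ (λ ())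
      too-long (d ∷ w) = g-false _ (λ ())

    ending-with-two : ∀ a b e → any (λ w → g (a ∷ b ∷ w ++ [ x ])) (subseqs e) ≡ g (a ∷ b ∷ x ∷ [])
    ending-with-two a b []      = ∨-identityʳ _
    ending-with-two a b (c ∷ e) = begin
      any (λ w → g (a ∷ b ∷ w ++ [ x ])) (map (c ∷_) (subseqs e) ++ subseqs e)
        ≡⟨ any-++ _ (map (c ∷_) (subseqs e)) (subseqs e) ⟩
      any (λ w → g (a ∷ b ∷ w ++ [ x ])) (map (c ∷_) (subseqs e)) ∨ any (λ w → g (a ∷ b ∷ w ++ [ x ])) (subseqs e)
        ≡⟨ cong₂ _∨_ (trans (any-map _ (c ∷_) (subseqs e)) (ending-with-three a b c e)) (ending-with-two a b e) ⟩
      g (a ∷ b ∷ x ∷ []) ∎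

    ending-with-one : ∀ a e → any (λ w → g (a ∷ w ++ [ x ])) (subseqs e) ≡ any (λ b → g (a ∷ b ∷ x ∷ [])) e
    ending-with-one a []      = trans (∨-identityʳ _) (g-false _ (λ ()))
    ending-with-one a (b ∷ e) = trans (any-++ _ (map (b ∷_) (subseqs e)) (subseqs e))
      (cong₂ _∨_ (trans (any-map _ (b ∷_) (subseqs e)) (ending-with-two a b e)) (ending-with-one a e))

  any-subseqs-ending : ∀ e → any (λ w → g (w ++ [ x ])) (subseqs e) ≡ anyPair (λ a b → g (a ∷ b ∷ x ∷ [])) e
  any-subseqs-ending []      = trans (∨-identityʳ _) (g-false _ (λ ()))
  any-subseqs-ending (a ∷ e) = trans (any-++ _ (map (a ∷_) (subseqs e)) (subseqs e))
    (cong₂ _∨_ (trans (any-map _ (a ∷_) (subseqs e)) (ending-with-one a e)) (any-subseqs-ending e))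

contains-snoc : ∀ f → length f ≡ 3 → ∀ e x →
                contains (e ++ [ x ]) f ≡ contains e f ∨ anyPair (λ a b → orderIso (a ∷ b ∷ x ∷ []) f) e
contains-snoc f |f|≡3 e x =
  trans (any-subseqs-snoc (λ w → orderIso w f) e x)
        (cong (contains e f ∨_) (any-subseqs-ending (λ w → orderIso w f) length≡3 x e))
  where
  length≡3 : ∀ w → orderIso w f ≡ true → length w ≡ 3
  length≡3 w iso = trans (orderIso-length w f iso) |f|≡3

formsPattern : List (List ℕ) → ℕ → ℕ → ℕ → Bool
formsPattern ps a b y = any (orderIso (a ∷ b ∷ y ∷ [])) ps

completesPattern : List (List ℕ) → List ℕ → ℕ → Bool
completesPattern ps e y = anyPair (λ a b → formsPattern ps a b y) e

avoidsAll-snoc : ∀ ps → All (λ f → length f ≡ 3) ps → ∀ e x →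
                 avoidsAll (e ++ [ x ]) ps ≡ avoidsAll e ps ∧ not (completesPattern ps e x)
avoidsAll-snoc []       []             e x = cong not (sym (anyPair-false e))
avoidsAll-snoc (f ∷ ps) (|f|≡3 ∷ |ps|) e x = begin
  not (contains (e ++ [ x ]) f) ∧ avoidsAll (e ++ [ x ]) ps
    ≡⟨ cong₂ (λ c a → not c ∧ a) (contains-snoc f |f|≡3 e x) (avoidsAll-snoc ps |ps| e x) ⟩
  not (contains e f ∨ P) ∧ (avoidsAll e ps ∧ not Q)
    ≡⟨ cong (_∧ (avoidsAll e ps ∧ not Q)) (not-∨ (contains e f) P) ⟩
  (not (contains e f) ∧ not P) ∧ (avoidsAll e ps ∧ not Q)
    ≡⟨ ∧-interchange (not (contains e f)) (not P) (avoidsAll e ps) (not Q) ⟩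
  (not (contains e f) ∧ avoidsAll e ps) ∧ (not P ∧ not Q)
    ≡⟨ cong (avoidsAll e (f ∷ ps) ∧_) (not-∨ P Q) ⟨
  avoidsAll e (f ∷ ps) ∧ not (P ∨ Q)
    ≡⟨ cong (λ c → avoidsAll e (f ∷ ps) ∧ not c)
            (anyPair-∨ (λ a b → orderIso (a ∷ b ∷ x ∷ []) f) (λ a b → formsPattern ps a b x) e) ⟨
  avoidsAll e (f ∷ ps) ∧ not (completesPattern (f ∷ ps) e x) ∎
  where
  P = anyPair (λ a b → orderIso (a ∷ b ∷ x ∷ []) f) e
  Q = completesPattern ps e x

patterns-length : All (λ f → length f ≡ 3) patterns
patterns-length = refl ∷ refl ∷ refl ∷ refl ∷ []

-- formsPattern is a Boolean function of the three comparisons among a, b and y; exposing them as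
-- data turns formsPattern-closed into a finite table.

data Comparison : Set where
  less equal greater : Comparison

compareℕ : ℕ → ℕ → Comparison
compareℕ zero    zero    = equal
compareℕ zero    (suc n) = less
compareℕ (suc m) zero    = greater
compareℕ (suc m) (suc n) = compareℕ m n

isLess isEqual isGreater : Comparison → Bool
isLess less = true
isLess _    = false
isEqual equal = true
isEqual _     = false
isGreater greater = true
isGreater _       = false

<ᵇ-compare : ∀ m n → (m <ᵇ n) ≡ isLess (compareℕ m n)
<ᵇ-compare zero    zero    = refl
<ᵇ-compare zero    (suc n) = refl
<ᵇ-compare (suc m) zero    = refl
<ᵇ-compare (suc m) (suc n) = <ᵇ-compare m n

≡ᵇ-compare : ∀ m n → (m ≡ᵇ n) ≡ isEqual (compareℕ m n)
≡ᵇ-compare zero    zero    = refl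
≡ᵇ-compare zero    (suc n) = refl
≡ᵇ-compare (suc m) zero    = refl
≡ᵇ-compare (suc m) (suc n) = ≡ᵇ-compare m n

>ᵇ-compare : ∀ m n → (n <ᵇ m) ≡ isGreater (compareℕ m n)
>ᵇ-compare zero    zero    = refl
>ᵇ-compare zero    (suc n) = refl
>ᵇ-compare (suc m) zero    = refl
>ᵇ-compare (suc m) (suc n) = >ᵇ-compare m n

formsPattern-closed : ∀ a b y → formsPattern patterns a b y ≡ not (a <ᵇ y) ∧ ((a <ᵇ b) ∧ (y <ᵇ b) ∨ (b <ᵇ a) ∧ (b <ᵇ y))
formsPattern-closed a b y
  rewrite <ᵇ-compare a b | ≡ᵇ-compare a b | >ᵇ-compare a b | <ᵇ-compare a y | ≡ᵇ-compare a y
        | <ᵇ-compare b y | ≡ᵇ-compare b y | >ᵇ-compare b y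
  with compareℕ a b | compareℕ a y | compareℕ b y
... | less    | less    | _       = refl
... | less    | equal   | less    = refl
... | less    | equal   | equal   = refl
... | less    | equal   | greater = refl
... | less    | greater | less    = refl
... | less    | greater | equal   = refl
... | less    | greater | greater = refl
... | equal   | less    | _       = refl
... | equal   | equal   | _       = refl
... | equal   | greater | _       = refl
... | greater | less    | _       = refl
... | greater | equal   | less    = refl
... | greater | equal   | equal   = refl
... | greater | equal   | greater = refl
... | greater | greater | less    = refl
... | greater | greater | equal   = refl
... | greater | greater | greater = refl

formsPattern-rise : ∀ a b y → a < y → formsPattern patterns a b y ≡ false
formsPattern-rise a b y a<y rewrite formsPattern-closed a b y | <ᵇ-true a<y = refl

formsPattern-nonincreasing : ∀ a b y → b ≤ a → y ≤ b → formsPattern patterns a b y ≡ false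
formsPattern-nonincreasing a b y b≤a y≤b
  rewrite formsPattern-closed a b y | <ᵇ-false (≤-trans y≤b b≤a) | <ᵇ-false b≤a | <ᵇ-false y≤b = ∧-zeroʳ (b <ᵇ a)

formsPattern-peak : ∀ a b y → a < b → y ≤ a → formsPattern patterns a b y ≡ true
formsPattern-peak a b y a<b y≤a
  rewrite formsPattern-closed a b y | <ᵇ-false y≤a | <ᵇ-true a<b | <ᵇ-true (≤-<-trans y≤a a<b) = refl

formsPattern-valley : ∀ a b y → b < a → b < y → y ≤ a → formsPattern patterns a b y ≡ true
formsPattern-valley a b y b<a b<y y≤a
  rewrite formsPattern-closed a b y | <ᵇ-false y≤a | <ᵇ-false (<⇒≤ b<a) | <ᵇ-true b<a | <ᵇ-true b<y = refl

lrState : ℕ → ℕ → List ℕ → ℕ × ℕ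
lrState j m []       = j , m
lrState j m (x ∷ xs) with m <ᵇ suc x
... | true  = lrState (suc j) (suc x) xs
... | false = lrState (suc j) m xs

lrHighFrom-snoc : ∀ j m e x →
  lrHighFrom j m (e ++ [ x ]) ≡ lrHighFrom j m e ∧ lrHighFrom (proj₁ (lrState j m e)) (proj₂ (lrState j m e)) [ x ]
lrHighFrom-snoc j m []      x = refl
lrHighFrom-snoc j m (y ∷ e) x with m <ᵇ suc y
... | true  = trans (cong ((y ≡ᵇ (j ∸ 1)) ∧_) (lrHighFrom-snoc (suc j) (suc y) e x)) (sym (∧-assoc (y ≡ᵇ (j ∸ 1)) _ _))
... | false = lrHighFrom-snoc (suc j) m e x

lrState-snoc : ∀ j m e x → lrState j m (e ++ [ x ]) ≡ lrState (proj₁ (lrState j m e)) (proj₂ (lrState j m e)) [ x ]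
lrState-snoc j m []      x = refl
lrState-snoc j m (y ∷ e) x with m <ᵇ suc y
... | true  = lrState-snoc (suc j) (suc y) e x
... | false = lrState-snoc (suc j) m e x

lrHigh-last-small : ∀ n M x → x ≤ M → lrHighFrom (suc n) (suc M) [ x ] ≡ true
lrHigh-last-small n M x x≤M rewrite <ᵇ-false x≤M = refl

lrHigh-last-middle : ∀ n M x → M < x → x < n → lrHighFrom (suc n) (suc M) [ x ] ≡ false
lrHigh-last-middle n M x M<x x<n rewrite <ᵇ-true M<x | ≡ᵇ-false (<⇒≢ x<n) = refl

lrHigh-last-high : ∀ n M → M < n → lrHighFrom (suc n) (suc M) [ n ] ≡ true
lrHigh-last-high n M M<n rewrite <ᵇ-true M<n | ≡ᵇ-true {n} refl = refl

lrState-last-small : ∀ n M x → x ≤ M → lrState (suc n) (suc M) [ x ] ≡ (suc (suc n) , suc M)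
lrState-last-small n M x x≤M rewrite <ᵇ-false x≤M = refl

lrState-last-high : ∀ n M → M < n → lrState (suc n) (suc M) [ n ] ≡ (suc (suc n) , suc n)
lrState-last-high n M M<n rewrite <ᵇ-true M<n = refl

-- The generating tree of the inversion sequences

valid : List ℕ → Bool
valid e = avoidsAll e patterns ∧ allLRMaxHigh e

step : ℕ × ℕ × ℕ → ℕ → ℕ × ℕ × ℕ
step (L , v , M) x = if M <ᵇ x then (suc M , x , x) else (L , x , M)

state : List ℕ → ℕ × ℕ × ℕ
state = foldl step (0 , 0 , 0)

state-snoc : ∀ e x → state (e ++ [ x ]) ≡ step (state e) x
state-snoc e x = foldl-++ step (0 , 0 , 0) e [ x ]

valid-snoc : ∀ e x → valid (e ++ [ x ]) ≡
  (avoidsAll e patterns ∧ not (completesPattern patterns e x))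
  ∧ (allLRMaxHigh e ∧ lrHighFrom (proj₁ (lrState 1 0 e)) (proj₂ (lrState 1 0 e)) [ x ])
valid-snoc e x = cong₂ _∧_ (avoidsAll-snoc patterns patterns-length e x) (lrHighFrom-snoc 1 0 e x)

invalid-snoc : ∀ e x → valid e ≡ false → valid (e ++ [ x ]) ≡ false
invalid-snoc e x invalid = trans (valid-snoc e x) (lemma (avoidsAll e patterns) (allLRMaxHigh e) _ _ invalid)
  where
  lemma : ∀ a b c d → (a ∧ b) ≡ false → ((a ∧ c) ∧ (b ∧ d)) ≡ false
  lemma false b     c d _ = refl
  lemma true  false c d _ = ∧-zeroʳ c

forbidden : ℕ → ℕ → ℕ → ℕ → Bool
forbidden L v M y = (y <ᵇ L) ∨ ((v <ᵇ y) ∧ (y <ᵇ suc M))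

forbidden-low : ∀ {L v M y} → y < L → forbidden L v M y ≡ true
forbidden-low y<L rewrite <ᵇ-true y<L = refl

forbidden-middle : ∀ {L v M y} → L ≤ y → y ≤ v → forbidden L v M y ≡ false
forbidden-middle L≤y y≤v rewrite <ᵇ-false L≤y | <ᵇ-false y≤v = refl

forbidden-high : ∀ {L v M y} → L ≤ y → v < y → y ≤ M → forbidden L v M y ≡ true
forbidden-high L≤y v<y y≤M rewrite <ᵇ-false L≤y | <ᵇ-true v<y | <ᵇ-true (s≤s y≤M) = refl

forbidden-top : ∀ {L v M y} → L ≤ y → M < y → forbidden L v M y ≡ false
forbidden-top {v = v} {y = y} L≤y M<y rewrite <ᵇ-false L≤y | <ᵇ-false M<y = ∧-zeroʳ (v <ᵇ y)

-- M is the maximum and v the last entry of e, and L is one more than the maximum that e had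
-- before its last left-to-right maximum (L = 0 for e = [ 0 ]).

record Profile (n : ℕ) (e : List ℕ) : Set where
  field
    L v M      : ℕ
    state≡     : state e ≡ (L , v , M)
    L≤v        : L ≤ v
    v≤M        : v ≤ M
    M<n        : M < n
    lrState≡   : lrState 1 0 e ≡ (suc n , suc M)
    all≤M      : All (_≤ M) e
    M∈e        : M ∈ e
    v∈e        : v ∈ e
    gap        : All (λ a → a < L ⊎ v ≤ a) e
    completes≡ : ∀ y → completesPattern patterns e y ≡ forbidden L v M y
    valid≡     : valid e ≡ true

profile-[0] : Profile 1 (0 ∷ [])
profile-[0] = record
  { L = 0 ; v = 0 ; M = 0 ; state≡ = refl ; L≤v = z≤n ; v≤M = z≤n ; M<n = s≤s z≤n ; lrState≡ = refl
  ; all≤M = z≤n ∷ [] ; M∈e = here refl ; v∈e = here refl ; gap = inj₂ z≤n ∷ []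
  ; completes≡ = λ { zero → refl ; (suc y) → refl } ; valid≡ = refl }

completesPattern-snoc : ∀ ps e x y →
  completesPattern ps (e ++ [ x ]) y ≡ completesPattern ps e y ∨ any (λ a → formsPattern ps a x y) e
completesPattern-snoc ps e x y = anyPair-snoc (λ a b → formsPattern ps a b y) e x

module Extension {n : ℕ} {e : List ℕ} (P : Profile n e) where
  open Profile P

  valid-extend : ∀ x → valid (e ++ [ x ]) ≡ not (forbidden L v M x) ∧ lrHighFrom (suc n) (suc M) [ x ]
  valid-extend x = begin
    valid (e ++ [ x ])
      ≡⟨ valid-snoc e x ⟩
    (avoidsAll e patterns ∧ not (completesPattern patterns e x)) ∧ (allLRMaxHigh e ∧ lrHighFrom j m [ x ])
      ≡⟨ cong₂ (λ a h → (a ∧ not (completesPattern patterns e x)) ∧ (h ∧ lrHighFrom j m [ x ]))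
               (∧-true-projˡ {b = allLRMaxHigh e} valid≡) (∧-true-projʳ {a = avoidsAll e patterns} valid≡) ⟩
    not (completesPattern patterns e x) ∧ lrHighFrom j m [ x ]
      ≡⟨ cong₂ (λ c jm → not c ∧ lrHighFrom (proj₁ jm) (proj₂ jm) [ x ]) (completes≡ x) lrState≡ ⟩
    not (forbidden L v M x) ∧ lrHighFrom (suc n) (suc M) [ x ] ∎
    where
    j = proj₁ (lrState 1 0 e)
    m = proj₂ (lrState 1 0 e)

  state-extend : ∀ x → state (e ++ [ x ]) ≡ step (L , v , M) x
  state-extend x rewrite state-snoc e x | state≡ = refl

  lrState-extend : ∀ x → lrState 1 0 (e ++ [ x ]) ≡ lrState (suc n) (suc M) [ x ]
  lrState-extend x rewrite lrState-snoc 1 0 e x | lrState≡ = refl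

  completes-inner : ∀ x → L ≤ x → x ≤ v → ∀ y → completesPattern patterns (e ++ [ x ]) y ≡ forbidden L x M y
  completes-inner x L≤x x≤v y rewrite completesPattern-snoc patterns e x y | completes≡ y with y <? L
  ... | yes y<L = trans (cong (_∨ _) (forbidden-low y<L)) (sym (forbidden-low y<L))
  ... | no  y≮L with y ≤? x
  ...   | yes y≤x = trans (cong₂ _∨_ (forbidden-middle L≤y (≤-trans y≤x x≤v)) (All-any-false _ gap no-occurrence))
                          (sym (forbidden-middle L≤y y≤x))
    where
    L≤y = ≮⇒≥ y≮L
    no-occurrence : ∀ {a} → a < L ⊎ v ≤ a → formsPattern patterns a x y ≡ false
    no-occurrence {a} (inj₁ a<L) = formsPattern-rise a x y (<-≤-trans a<L L≤y)
    no-occurrence {a} (inj₂ v≤a) = formsPattern-nonincreasing a x y (≤-trans x≤v v≤a) y≤x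
  ...   | no  y≰x with y ≤? v
  ...     | yes y≤v = trans (cong (forbidden L v M y ∨_) (any-true _ v∈e valley)) (trans (∨-zeroʳ _)
                          (sym (forbidden-high (≮⇒≥ y≮L) (≰⇒> y≰x) (≤-trans y≤v v≤M))))
    where
    valley = formsPattern-valley v x y (<-≤-trans (≰⇒> y≰x) y≤v) (≰⇒> y≰x) y≤v
  ...     | no  y≰v with y ≤? M
  ...       | yes y≤M = trans (cong (_∨ _) (forbidden-high (≮⇒≥ y≮L) (≰⇒> y≰v) y≤M))
                              (sym (forbidden-high (≮⇒≥ y≮L) (≰⇒> y≰x) y≤M))
  ...       | no  y≰M = trans (cong₂ _∨_ (forbidden-top (≮⇒≥ y≮L) M<y) (All-any-false _ all≤M (λ {a} a≤M → formsPattern-rise a x y (≤-<-trans a≤M M<y))))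
                              (sym (forbidden-top (≮⇒≥ y≮L) M<y))
    where
    M<y = ≰⇒> y≰M

  completes-high : ∀ y → completesPattern patterns (e ++ [ n ]) y ≡ forbidden (suc M) n n y
  completes-high y rewrite completesPattern-snoc patterns e n y | completes≡ y with y ≤? M
  ... | yes y≤M = trans (cong (forbidden L v M y ∨_) (any-true _ M∈e (formsPattern-peak M n y M<n y≤M)))
                        (trans (∨-zeroʳ _) (sym (forbidden-low (s≤s y≤M))))
  ... | no  y≰M = trans (cong₂ _∨_ (forbidden-top (≤-trans (≤-trans L≤v v≤M) (<⇒≤ M<y)) M<y)
                                   (All-any-false _ all≤M (λ {a} a≤M → formsPattern-rise a n y (≤-<-trans a≤M M<y))))
                        (sym new-forbidden)
    where
    M<y = ≰⇒> y≰M
    new-forbidden : forbidden (suc M) n n y ≡ false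
    new-forbidden with y ≤? n
    ... | yes y≤n = forbidden-middle M<y y≤n
    ... | no  y≰n = forbidden-top M<y (≰⇒> y≰n)

  extend-inner : ∀ x → L ≤ x → x ≤ v → Profile (suc n) (e ++ [ x ])
  extend-inner x L≤x x≤v = record
    { L = L ; v = x ; M = M
    ; state≡ = trans (state-extend x) (cong (λ b → if b then (suc M , x , x) else (L , x , M)) (<ᵇ-false x≤M))
    ; L≤v = L≤x ; v≤M = x≤M ; M<n = m<n⇒m<1+n M<n
    ; lrState≡ = trans (lrState-extend x) (lrState-last-small n M x x≤M)
    ; all≤M = All.++⁺ all≤M (x≤M ∷ [])
    ; M∈e = Any.++⁺ˡ M∈e
    ; v∈e = Any.++⁺ʳ e (here refl)
    ; gap = All.++⁺ (All.map (map₂ (≤-trans x≤v)) gap) (inj₂ ≤-refl ∷ [])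
    ; completes≡ = completes-inner x L≤x x≤v
    ; valid≡ = trans (valid-extend x) (cong₂ (λ b c → not b ∧ c) (forbidden-middle L≤x x≤v) (lrHigh-last-small n M x x≤M)) }
    where
    x≤M = ≤-trans x≤v v≤M

  extend-high : Profile (suc n) (e ++ [ n ])
  extend-high = record
    { L = suc M ; v = n ; M = n
    ; state≡ = trans (state-extend n) (cong (λ b → if b then (suc M , n , n) else (L , n , M)) (<ᵇ-true M<n))
    ; L≤v = M<n ; v≤M = ≤-refl ; M<n = ≤-refl
    ; lrState≡ = trans (lrState-extend n) (lrState-last-high n M M<n)
    ; all≤M = All.++⁺ (All.map (λ a≤M → ≤-trans a≤M (<⇒≤ M<n)) all≤M) (≤-refl ∷ [])
    ; M∈e = Any.++⁺ʳ e (here refl)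
    ; v∈e = Any.++⁺ʳ e (here refl)
    ; gap = All.++⁺ (All.map (inj₁ ∘ s≤s) all≤M) (inj₂ ≤-refl ∷ [])
    ; completes≡ = completes-high
    ; valid≡ = trans (valid-extend n)
        (cong₂ (λ b c → not b ∧ c) (forbidden-top (≤-trans (≤-trans L≤v v≤M) (<⇒≤ M<n)) M<n) (lrHigh-last-high n M M<n)) }

  extend-invalid : ∀ x → x < n → ¬ (L ≤ x × x ≤ v) → valid (e ++ [ x ]) ≡ false
  extend-invalid x x<n x∉[L,v] rewrite valid-extend x with x <? L
  ... | yes x<L rewrite forbidden-low {L} {v} {M} x<L = refl
  ... | no  x≮L with x ≤? v
  ...   | yes x≤v = ⊥-elim (x∉[L,v] (≮⇒≥ x≮L , x≤v))
  ...   | no  x≰v with x ≤? M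
  ...     | yes x≤M rewrite forbidden-high {L} {v} {M} (≮⇒≥ x≮L) (≰⇒> x≰v) x≤M = refl
  ...     | no  x≰M rewrite lrHigh-last-middle n M x (≰⇒> x≰M) x<n = ∧-zeroʳ _

  extend-valid : ∀ x → x ≤ n → valid (e ++ [ x ]) ≡ true → Profile (suc n) (e ++ [ x ])
  extend-valid x x≤n valid-ex with x <? n
  ... | no  x≮n rewrite ≤-antisym x≤n (≮⇒≥ x≮n) = extend-high
  ... | yes x<n with L ≤? x | x ≤? v
  ...   | yes L≤x | yes x≤v = extend-inner x L≤x x≤v
  ...   | no  L≰x | _       = contradiction (trans (sym valid-ex) (extend-invalid x x<n (L≰x ∘ proj₁))) λ ()
  ...   | yes _   | no  x≰v = contradiction (trans (sym valid-ex) (extend-invalid x x<n (x≰v ∘ proj₂))) λ ()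

∑-window : ∀ n L v (h G : ℕ → ℕ) C → L ≤ v → v < n →
  (∀ x → x < L → h x ≡ 0) → (∀ x → L ≤ x → x ≤ v → h x ≡ G (x ∸ L)) → (∀ x → v < x → x < n → h x ≡ 0) → h n ≡ C →
  ∑< (suc n) h ≡ C + ∑< (suc (v ∸ L)) G
∑-window n L v h G C L≤v v<n below inside above at-n = begin
  ∑< (suc n) h
    ≡⟨ ∑-last n h ⟩
  ∑< n h + h n
    ≡⟨ cong₂ _+_ (cong (λ k → ∑< k h) (sym n≡)) at-n ⟩
  ∑< (L + (suc a + r)) h + C
    ≡⟨ cong (_+ C) (∑-++ L (suc a + r) h) ⟩
  ∑< L h + ∑[ i < suc a + r ] h (L + i) + C
    ≡⟨ cong (λ z → z + ∑[ i < suc a + r ] h (L + i) + C) (∑-zero L below) ⟩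
  ∑[ i < suc a + r ] h (L + i) + C
    ≡⟨ cong (_+ C) (∑-++ (suc a) r (λ i → h (L + i))) ⟩
  ∑[ i < suc a ] h (L + i) + ∑[ i < r ] h (L + (suc a + i)) + C
    ≡⟨ cong₂ (λ z w → z + w + C) (∑-cong (suc a) window) (∑-zero r beyond) ⟩
  ∑< (suc a) G + 0 + C
    ≡⟨ trans (cong (_+ C) (+-identityʳ _)) (+-comm _ C) ⟩
  C + ∑< (suc (v ∸ L)) G ∎
  where
  a = v ∸ L
  r = n ∸ suc v
  L+a≡v : L + a ≡ v
  L+a≡v = m+[n∸m]≡n L≤v
  L+[1+a+i]≡1+v+i : ∀ i → L + (suc a + i) ≡ suc v + i
  L+[1+a+i]≡1+v+i i = trans (sym (+-assoc L (suc a) i)) (cong (_+ i) (trans (+-suc L a) (cong suc L+a≡v)))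
  n≡ : L + (suc a + r) ≡ n
  n≡ = trans (L+[1+a+i]≡1+v+i r) (m+[n∸m]≡n v<n)
  window : ∀ i → i < suc a → h (L + i) ≡ G i
  window i i≤a = trans (inside (L + i) (m≤m+n L i) (subst (L + i ≤_) L+a≡v (+-monoʳ-≤ L (≤-pred i≤a))))
                       (cong G (m+n∸m≡n L i))
  beyond : ∀ i → i < r → h (L + (suc a + i)) ≡ 0
  beyond i i<r = above _ (subst (v <_) (sym (L+[1+a+i]≡1+v+i i)) (s≤s (m≤m+n v i)))
                         (subst (_< n) (sym (L+[1+a+i]≡1+v+i i)) (subst (suc v + i <_) (m+[n∸m]≡n v<n) (+-monoʳ-< (suc v) i<r)))

slack maximum : List ℕ → ℕ
slack   e = proj₁ (proj₂ (state e)) ∸ proj₁ (state e)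
maximum e = proj₂ (proj₂ (state e))

weight : ℕ → (ℕ → ℕ → ℕ) → List ℕ → ℕ
weight n g e = if valid e then g (slack e) (n ∸ suc (maximum e)) else 0

weight-invalid : ∀ n g e → valid e ≡ false → weight n g e ≡ 0
weight-invalid n g e v≡false rewrite v≡false = refl

weight-profile : ∀ {n e} → (P : Profile n e) → ∀ g →
                 weight n g e ≡ g (Profile.v P ∸ Profile.L P) (n ∸ suc (Profile.M P))
weight-profile P g rewrite Profile.valid≡ P | Profile.state≡ P = refl

∸-suc : ∀ n M → M < n → n ∸ M ≡ suc (n ∸ suc M)
∸-suc (suc n) zero    _         = refl
∸-suc (suc n) (suc M) (s≤s M<n) = ∸-suc n M M<n

weight-children : ∀ {n e} → Profile n e → ∀ g →
  ∑[ x < suc n ] weight (suc n) g (e ++ [ x ]) ≡ ∑children g (slack e) (n ∸ suc (maximum e))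
weight-children {n} {e} P g =
  trans (∑-window n L v h (λ i → g i (suc d)) (g d 0) L≤v (≤-<-trans v≤M M<n) below inside above at-n)
        (cong₂ (λ a M′ → ∑children g a (n ∸ suc M′)) (sym slack≡) (sym maximum≡))
  where
  open Profile P
  open Extension P
  h = λ x → weight (suc n) g (e ++ [ x ])
  d = n ∸ suc M
  slack≡ : slack e ≡ v ∸ L
  slack≡ rewrite state≡ = refl
  maximum≡ : maximum e ≡ M
  maximum≡ rewrite state≡ = refl
  below : ∀ x → x < L → h x ≡ 0
  below x x<L = weight-invalid (suc n) g (e ++ [ x ])
    (extend-invalid x (<-≤-trans x<L (≤-trans L≤v (≤-trans v≤M (<⇒≤ M<n)))) (λ (L≤x , _) → <-irrefl refl (<-≤-trans x<L L≤x)))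
  inside : ∀ x → L ≤ x → x ≤ v → h x ≡ g (x ∸ L) (suc d)
  inside x L≤x x≤v = trans (weight-profile (extend-inner x L≤x x≤v) g) (cong (g (x ∸ L)) (∸-suc n M M<n))
  above : ∀ x → v < x → x < n → h x ≡ 0
  above x v<x x<n = weight-invalid (suc n) g (e ++ [ x ])
    (extend-invalid x x<n (λ (_ , x≤v) → <-irrefl refl (<-≤-trans v<x x≤v)))
  at-n : h n ≡ g d 0
  at-n = trans (weight-profile extend-high g) (cong (g d) (n∸n≡0 n))

profiles : ∀ m → All (λ e → valid e ≡ true → Profile (suc m) e) (invSeqs (suc m))
profiles zero    = (λ _ → profile-[0]) ∷ []
profiles (suc m) = All.concat⁺ (All.map⁺ (All.map (λ {e} → children e) (profiles m)))
  where
  n = suc m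
  child : ∀ e → (valid e ≡ true → Profile n e) → ∀ x → x < suc n → valid (e ++ [ x ]) ≡ true → Profile (suc n) (e ++ [ x ])
  child e profile x x≤n valid-ex with valid e in valid-e
  ... | false = contradiction (trans (sym valid-ex) (invalid-snoc e x valid-e)) λ ()
  ... | true  = Extension.extend-valid (profile refl) x (≤-pred x≤n) valid-ex
  children : ∀ e → (valid e ≡ true → Profile n e) →
             All (λ e′ → valid e′ ≡ true → Profile (suc n) e′) (map (λ x → e ++ [ x ]) (upTo (suc n)))
  children e profile = All.map⁺ (All.applyUpTo⁺₁ (λ x → x) (suc n) (λ {x} x≤n → child e profile x x≤n))

totalWeight : ℕ → (ℕ → ℕ → ℕ) → ℕ
totalWeight n g = ∑[ e ∈ invSeqs n ] weight n g e

totalWeight-suc : ∀ m g → totalWeight (suc (suc m)) g ≡ totalWeight (suc m) (∑children g)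
totalWeight-suc m g = begin
  ∑∈ (concatMap extensions (invSeqs n)) (weight (suc n) g)
    ≡⟨ ∑∈-concatMap extensions (invSeqs n) (weight (suc n) g) ⟩
  ∑[ e ∈ invSeqs n ] ∑∈ (extensions e) (weight (suc n) g)
    ≡⟨ ∑∈-cong (invSeqs n) (All.map (λ {e} → totalWeight-extensions e) (profiles m)) ⟩
  ∑[ e ∈ invSeqs n ] weight n (∑children g) e ∎
  where
  n = suc m
  extensions : List ℕ → List (List ℕ)
  extensions e = map (λ x → e ++ [ x ]) (upTo (suc n))
  totalWeight-extensions : ∀ e → (valid e ≡ true → Profile n e) → ∑∈ (extensions e) (weight (suc n) g) ≡ weight n (∑children g) e
  totalWeight-extensions e profile with valid e in valid-e
  ... | true  = trans (∑∈-map (λ x → e ++ [ x ]) (upTo (suc n)) (weight (suc n) g))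
                      (trans (∑∈-applyUpTo (λ x → x) (suc n) (λ x → weight (suc n) g (e ++ [ x ])))
                             (weight-children (profile refl) g))
  ... | false = trans (∑∈-map (λ x → e ++ [ x ]) (upTo (suc n)) (weight (suc n) g))
                      (∑∈-zero (upTo (suc n)) (λ x → weight-invalid (suc n) g (e ++ [ x ]) (invalid-snoc e x valid-e)))

totalWeight-tree : ∀ k r → totalWeight (suc k) (tree r) ≡ tree (k + r) 0 0
totalWeight-tree zero    r = +-identityʳ _
totalWeight-tree (suc k) r = trans (totalWeight-suc k (tree r)) (trans (totalWeight-tree k (suc r)) (cong (λ s → tree s 0 0) (+-suc k r)))

countInv≡tree : ∀ m → countInv (suc m) ≡ tree m 0 0
countInv≡tree m = begin
  countInv (suc m)         ≡⟨ length-filterᵇ valid (invSeqs (suc m)) ⟩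
  totalWeight (suc m) (tree 0)   ≡⟨ totalWeight-tree m 0 ⟩
  tree (m + 0) 0 0         ≡⟨ cong (λ s → tree s 0 0) (+-identityʳ m) ⟩
  tree m 0 0               ∎

proposition14 : (n : ℕ) → 1 ≤ n → countInv n ≡ countRushed (suc n)
proposition14 (suc m) _ = begin
  countInv (suc m)             ≡⟨ countInv≡tree m ⟩
  tree m 0 0                   ≡⟨ rushedTotal≡tree m ⟨
  rushedTotal (suc m)          ≡⟨ countRushed≡rushedTotal (suc m) ⟨
  countRushed (suc (suc m))    ∎
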